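{- Let $G$ be a graph, let $k$ be a positive integer, let $D$ be a $k$-optimal set in $G$, and let $X = V(G) - D$. Let $H$ be the bipartite subgraph of $G$ with vertex set $V(G)$, partite sets $D$ and $X$, and edge set consisting of all edges of $G$ having one endpoint in $D$ and the other in $X$. If $J$ is any orientation of the induced subgraph $G[X]$, then $H$ has a $k$-edge-chromatic subgraph $M$ such that $d_M(v) + d^{+}_J(v) \geq k$ for all $v \in X$, where $d^{+}_J(v)$ is the outdegree of $v$ in $J$.
   Context: Graphs are finite and simple. A vertex set $D \subseteq V(G)$ is $k$-dependent if the induced subgraph $G[D]$ has maximum degree at most $k-1$. For a vertex set $D$, $\phi_k(D) = k|D| - |E(G[D])|$. A $k$-optimal set is a $k$-dependent set maximizing $\phi_k$ over all $k$-dependent sets of $G$. A graph is $k$-edge-chromatic if its edges can be properly colored with at most $k$ colors (equivalently, its edge set is a union of $k$ pairwise disjoint matchings). $d_M(v)$ denotes the degree of $v$ in $M$. -}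

module Defs where

open import Data.Nat using (ℕ; _+_; _*_; _≤_; _<ᵇ_)
open import Data.Bool using (Bool; true; false; _∧_; not; T)
open import Data.Fin using (Fin; toℕ)
open import Data.Fin.Subset using (Subset; ∣_∣)
open import Data.Vec using (lookup; tabulate)
open import Data.List using (map; allFin)
open import Data.Nat.ListAction using (sum)
open import Data.Integer using (ℤ; +_; _-_)
open import Data.Product using (Σ; _×_)
open import Relation.Binary.PropositionalEquality using (_≡_)
open import Relation.Nullary using (¬_)

record Graph (n : ℕ) : Set where
  field
    adj   : Fin n → Fin n → Bool
    sym   : ∀ u v → adj u v ≡ adj v u
    irrefl : ∀ v → adj v v ≡ false
open Graph public

count : ∀ {n} → (Fin n → Bool) → ℕ
count f = ∣ tabulate f ∣

degIn : ∀ {n} → Graph n → Subset n → Fin n → ℕ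
degIn G D v = count (λ u → lookup D u ∧ adj G v u)

edgesIn : ∀ {n} → Graph n → Subset n → ℕ
edgesIn {n} G D =
  sum (map (λ u → count (λ w → lookup D u ∧ lookup D w ∧ adj G u w ∧ (toℕ u <ᵇ toℕ w))) (allFin n))

kDependent : ∀ {n} → ℕ → Graph n → Subset n → Set
kDependent {n} k G D = ∀ v → T (lookup D v) → 1 + degIn G D v ≤ k

φ : ∀ {n} → ℕ → Graph n → Subset n → ℤ
φ k G D = + (k * ∣ D ∣) - + (edgesIn G D)

kOptimal : ∀ {n} → ℕ → Graph n → Subset n → Set
kOptimal {n} k G D =
  kDependent k G D × (∀ (D′ : Subset n) → kDependent k G D′ → φ k G D′ Data.Integer.≤ φ k G D)

complementOf : ∀ {n} → Subset n → Subset n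
complementOf D = tabulate (λ v → not (lookup D v))

-- J is an orientation of G[X]: J u v means arc u → v
IsOrientation : ∀ {n} → Graph n → Subset n → (Fin n → Fin n → Bool) → Set
IsOrientation {n} G X J =
  (∀ u v → T (J u v) → T (lookup X u ∧ lookup X v ∧ adj G u v)) ×
  (∀ u v → T (lookup X u ∧ lookup X v ∧ adj G u v) → T (J u v) ⊎' T (J v u)) ×
  (∀ u v → T (J u v) → ¬ T (J v u))
  where
    open import Data.Sum using () renaming (_⊎_ to _⊎'_)

outdeg : ∀ {n} → (Fin n → Fin n → Bool) → Fin n → ℕ
outdeg J v = count (λ u → J v u)

IsSubgraphOfH : ∀ {n} → Graph n → Subset n → (Fin n → Fin n → Bool) → Set
IsSubgraphOfH {n} G D M =
  (∀ u v → M u v ≡ M v u) ×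
  (∀ u v → T (M u v) → T (adj G u v ∧ (lookup D u ∧ not (lookup D v)))
                        Data.Sum.⊎ T (adj G u v ∧ (not (lookup D u) ∧ lookup D v)))
  where import Data.Sum

KEdgeChromatic : ∀ {n} → ℕ → (Fin n → Fin n → Bool) → Set
KEdgeChromatic {n} k M =
  Σ (Fin n → Fin n → Fin k) λ c →
    (∀ u v → T (M u v) → c u v ≡ c v u) ×
    (∀ u v w → T (M u v) → T (M u w) → ¬ (v ≡ w) → ¬ (c u v ≡ c u w))

degM : ∀ {n} → (Fin n → Fin n → Bool) → Fin n → ℕ
degM M v = count (λ u → M v u)

module Submission where

-- M is built as a partial proper k-edge-colouring of H, kept so that every vertex v of X with a
-- coloured edge has d_M(v) + d⁺_J(v) ≤ k.  While some v₀ ∈ X has d_M(v₀) + d⁺_J(v₀) < k, search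
-- from v₀ along alternating steps (uncoloured edges out of X, coloured edges out of D).  If the
-- search meets an unsaturated vertex of D, the colours are shifted along the path, using a Kempe
-- swap as in König's edge-colouring theorem, so that d_M(v₀) grows by one and no other degree in X
-- changes.  Otherwise the reachable set R is closed and saturates all of R ∩ D, and exchanging R ∩ D
-- for R ∩ X in D raises φ_k: the loss k|R ∩ D| and the new edges between R ∩ X and D − R are paid
-- for by the colour degrees in R ∩ X, the new edges inside R ∩ X by its out-degrees, and the deficit
-- at v₀ makes the gain strict.  Deleting vertices of degree ≥ k then gives a k-dependent set
-- beating D, contradicting optimality.

import Algebra.Properties.CommutativeMonoid.Sum as CommutativeMonoidSum
import Algebra.Properties.Semiring.Sum as SemiringSum
open import Data.Bool using (Bool; true; false; T; not; _∧_; _∨_; _xor_; if_then_else_)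
open import Data.Bool.Properties
  using (T?; T-≡; T-∨; T-∧; not-¬; not-involutive; ∧-assoc; not-distribˡ-xor; xor-same; ∧-zeroʳ; ∧-identityʳ; ∨-identityʳ)
open import Data.Empty using (⊥; ⊥-elim)
open import Data.Fin using (Fin; zero; suc; toℕ)
open import Data.Fin.Permutation.Components using (transpose; transpose-inverse)
open import Data.Fin.Properties using (any?; all?; ¬∀⟶∃¬; suc-injective; toℕ-injective) renaming (_≟_ to _≟ᶠ_)
open import Data.Fin.Subset using (Subset; ∣_∣)
import Data.Integer as ℤ
import Data.Integer.Properties as ℤ
open import Data.Integer.Tactic.RingSolver using () renaming (solve-∀ to ℤ-solve-∀)
open import Data.List using (List; []; _∷_; length)
import Data.List as List
import Data.List.Properties as List
open import Data.List.Membership.Propositional using (_∈_; _∉_)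
open import Data.List.Membership.Propositional.Properties using (∈-allFin)
open import Data.List.Relation.Unary.All as All using (All; []; _∷_)
open import Data.List.Relation.Unary.Any using (here; there)
open import Data.Maybe using (Maybe; just; nothing; is-just; fromMaybe)
import Data.Maybe as Maybe
open import Data.Maybe.Properties using (just-injective; ≡-dec)
open import Data.Nat
open import Data.Nat.ListAction using () renaming (sum to sumˡ)
open import Data.Nat.Properties hiding (suc-injective)
open import Data.Nat.Solver using (module +-*-Solver)
open import Data.Product using (Σ; _×_; _,_; proj₁; proj₂)
open import Data.Sum using (_⊎_; inj₁; inj₂)
open import Data.Unit using (tt)
open import Data.Vec using (lookup; tabulate)
open import Data.Vec.Properties using (lookup∘tabulate; tabulate∘lookup)
open import Function using (_∘_; case_of_; Equivalence)
open import Relation.Binary.PropositionalEquality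
open import Relation.Nullary using (¬_; Dec; yes; no; does)
open import Relation.Nullary.Decidable using (dec-true; dec-false; decidable-stable; _×-dec_; _⊎-dec_; ¬?)
open import Defs hiding (sym)

open CommutativeMonoidSum +-0-commutativeMonoid using (sum; sum-cong-≗; ∑-distrib-+; ∑-comm; sum-replicate-zero)
open SemiringSum +-*-semiring using (*-distribˡ-sum)

⟦_⟧ : Bool → ℕ
⟦ true ⟧ = 1
⟦ false ⟧ = 0

⟦⟧≤1 : ∀ b → ⟦ b ⟧ ≤ 1
⟦⟧≤1 true = s≤s z≤n
⟦⟧≤1 false = z≤n

⟦⟧-∧ : ∀ x y → ⟦ x ∧ y ⟧ ≡ ⟦ x ⟧ * ⟦ y ⟧
⟦⟧-∧ true y = sym (+-identityʳ _)
⟦⟧-∧ false y = refl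

⟦T⟧ : ∀ {x} → T x → ⟦ x ⟧ ≡ 1
⟦T⟧ {true} _ = refl

⟦¬T⟧ : ∀ {x} → ¬ T x → ⟦ x ⟧ ≡ 0
⟦¬T⟧ {true} h = ⊥-elim (h tt)
⟦¬T⟧ {false} _ = refl

T-not⇒¬T : ∀ {x} → T (not x) → ¬ T x
T-not⇒¬T {false} _ ()

¬T⇒T-not : ∀ {x} → ¬ T x → T (not x)
¬T⇒T-not {false} _ = tt
¬T⇒T-not {true} ¬x = ¬x tt

¬T-flip : ∀ {x y} → x ≡ not y → ¬ T x → T y
¬T-flip {false} {true} _ _ = tt
¬T-flip {true} _ ¬x = ⊥-elim (¬x tt)

sum-mono-≤ : ∀ {n} {f g : Fin n → ℕ} → (∀ i → f i ≤ g i) → sum f ≤ sum g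
sum-mono-≤ {zero} f≤g = z≤n
sum-mono-≤ {suc n} f≤g = +-mono-≤ (f≤g zero) (sum-mono-≤ (f≤g ∘ suc))

sum-allFin : ∀ {n} (f : Fin n → ℕ) → sumˡ (List.map f (List.allFin n)) ≡ sum f
sum-allFin f = trans (cong sumˡ (List.map-tabulate (λ i → i) f)) (go f)
  where
  go : ∀ {n} (f : Fin n → ℕ) → sumˡ (List.tabulate f) ≡ sum f
  go {zero} f = refl
  go {suc n} f = cong (f zero +_) (go (f ∘ suc))

does-sound : ∀ {p} {P : Set p} (P? : Dec P) → T (does P?) → P
does-sound (yes p) _ = p

does-complete : ∀ {p} {P : Set p} (P? : Dec P) → P → T (does P?)
does-complete (yes _) _ = tt
does-complete (no ¬p) p = ¬p p

δ : ∀ {n} → Fin n → Fin n → ℕ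
δ i j = ⟦ does (i ≟ᶠ j) ⟧

δ-refl : ∀ {n} (i : Fin n) → δ i i ≡ 1
δ-refl i with i ≟ᶠ i
... | yes _ = refl
... | no i≢i = ⊥-elim (i≢i refl)

δ-≢ : ∀ {n} {i j : Fin n} → i ≢ j → δ i j ≡ 0
δ-≢ {i = i} {j} i≢j with i ≟ᶠ j
... | yes i≡j = ⊥-elim (i≢j i≡j)
... | no _ = refl

sum-δ : ∀ {n} (i : Fin n) (g : Fin n → ℕ) → sum (λ j → δ i j * g j) ≡ g i
sum-δ {suc n} zero g = begin
  1 * g zero + sum (λ j → 0 * g (suc j)) ≡⟨ cong₂ _+_ (*-identityˡ (g zero)) (sum-replicate-zero n) ⟩
  g zero + 0                             ≡⟨ +-identityʳ (g zero) ⟩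
  g zero                                 ∎
  where open ≡-Reasoning
sum-δ {suc n} (suc i) g = sum-δ i (g ∘ suc)

sum-δ-1 : ∀ {n} (i : Fin n) → sum (δ i) ≡ 1
sum-δ-1 i = trans (sum-cong-≗ (λ j → sym (*-identityʳ (δ i j)))) (sum-δ i (λ _ → 1))

#_ : ∀ {n} → (Fin n → Bool) → ℕ
# f = sum (λ i → ⟦ f i ⟧)

count≡# : ∀ {n} (f : Fin n → Bool) → count f ≡ # f
count≡# {zero} f = refl
count≡# {suc n} f with f zero
... | true = cong suc (count≡# (f ∘ suc))
... | false = count≡# (f ∘ suc)

#-cong : ∀ {n} {f g : Fin n → Bool} → (∀ i → f i ≡ g i) → # f ≡ # g
#-cong f≗g = sum-cong-≗ (cong ⟦_⟧ ∘ f≗g)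

#-≤ : ∀ {n} (f : Fin n → Bool) → # f ≤ n
#-≤ {zero} f = z≤n
#-≤ {suc n} f = +-mono-≤ (⟦⟧≤1 (f zero)) (#-≤ (f ∘ suc))

#-< : ∀ {n} (f : Fin n → Bool) (i : Fin n) → ¬ T (f i) → # f < n
#-< {suc n} f zero ¬fi rewrite ⟦¬T⟧ ¬fi = s≤s (#-≤ (f ∘ suc))
#-< {suc n} f (suc i) ¬fi =
  subst (_≤ suc n) (+-suc ⟦ f zero ⟧ (# (f ∘ suc))) (+-mono-≤ (⟦⟧≤1 (f zero)) (#-< (f ∘ suc) i ¬fi))

#-true : ∀ {n} → #_ {n} (λ _ → true) ≡ n
#-true {zero} = refl
#-true {suc n} = cong suc (#-true {n})

#-≥1 : ∀ {n} (f : Fin n → Bool) (i : Fin n) → T (f i) → 1 ≤ # f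
#-≥1 {suc n} f zero fi rewrite ⟦T⟧ fi = s≤s z≤n
#-≥1 {suc n} f (suc i) fi = ≤-trans (#-≥1 (f ∘ suc) i fi) (m≤n+m _ ⟦ f zero ⟧)

#-update : ∀ {n} (f g : Fin n → Bool) (i : Fin n) → (∀ j → i ≢ j → f j ≡ g j) →
  # f + ⟦ g i ⟧ ≡ # g + ⟦ f i ⟧
#-update {suc n} f g zero f≐g = begin
  ⟦ f zero ⟧ + # (f ∘ suc) + ⟦ g zero ⟧
    ≡⟨ cong (λ x → ⟦ f zero ⟧ + x + ⟦ g zero ⟧) (#-cong (λ j → f≐g (suc j) λ ())) ⟩
  ⟦ f zero ⟧ + # (g ∘ suc) + ⟦ g zero ⟧
    ≡⟨ solve 3 (λ a b c → a :+ b :+ c := c :+ b :+ a) refl ⟦ f zero ⟧ (# (g ∘ suc)) ⟦ g zero ⟧ ⟩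
  ⟦ g zero ⟧ + # (g ∘ suc) + ⟦ f zero ⟧ ∎
  where open ≡-Reasoning
        open +-*-Solver using (solve; _:+_; _:=_)
#-update {suc n} f g (suc i) f≐g = begin
  ⟦ f zero ⟧ + # (f ∘ suc) + ⟦ g (suc i) ⟧
    ≡⟨ +-assoc ⟦ f zero ⟧ _ _ ⟩
  ⟦ f zero ⟧ + (# (f ∘ suc) + ⟦ g (suc i) ⟧)
    ≡⟨ cong₂ _+_ (cong ⟦_⟧ (f≐g zero λ ()))
                 (#-update (f ∘ suc) (g ∘ suc) i (λ j i≢j → f≐g (suc j) (i≢j ∘ suc-injective))) ⟩
  ⟦ g zero ⟧ + (# (g ∘ suc) + ⟦ f (suc i) ⟧)
    ≡⟨ +-assoc ⟦ g zero ⟧ _ _ ⟨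
  ⟦ g zero ⟧ + # (g ∘ suc) + ⟦ f (suc i) ⟧ ∎
  where open ≡-Reasoning

#-remove : ∀ {n} (Q : Fin n → Bool) (i : Fin n) → T (Q i) → suc (# (λ j → Q j ∧ not (does (i ≟ᶠ j)))) ≡ # Q
#-remove Q i Qi = begin
  suc (# Q′)        ≡⟨ +-comm 1 (# Q′) ⟩
  # Q′ + 1          ≡⟨ cong (λ b → # Q′ + ⟦ b ⟧) (Equivalence.to T-≡ Qi) ⟨
  # Q′ + ⟦ Q i ⟧    ≡⟨ #-update Q′ Q i Q′≐Q ⟩
  # Q + ⟦ Q′ i ⟧    ≡⟨ cong (λ b → # Q + ⟦ Q i ∧ not b ⟧) (dec-true (i ≟ᶠ i) refl) ⟩
  # Q + ⟦ Q i ∧ false ⟧ ≡⟨ cong (λ b → # Q + ⟦ b ⟧) (∧-zeroʳ (Q i)) ⟩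
  # Q + 0           ≡⟨ +-identityʳ (# Q) ⟩
  # Q               ∎
  where
  open ≡-Reasoning
  Q′ : Fin _ → Bool
  Q′ j = Q j ∧ not (does (i ≟ᶠ j))
  Q′≐Q : ∀ j → i ≢ j → Q′ j ≡ Q j
  Q′≐Q j i≢j rewrite dec-false (i ≟ᶠ j) i≢j = ∧-identityʳ (Q j)

#-injection : ∀ {n m} (P : Fin n → Bool) (Q : Fin m → Bool) (h : Fin n → Fin m) →
  (∀ i → T (P i) → T (Q (h i))) → (∀ i j → T (P i) → T (P j) → h i ≡ h j → i ≡ j) → # P ≤ # Q
#-injection {zero} P Q h P⇒Qh inj = z≤n
#-injection {suc n} P Q h P⇒Qh inj with T? (P zero)
... | no ¬P0 rewrite ⟦¬T⟧ ¬P0 =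
  #-injection (P ∘ suc) Q (h ∘ suc) (P⇒Qh ∘ suc) (λ i j Pi Pj → suc-injective ∘ inj (suc i) (suc j) Pi Pj)
... | yes P0 rewrite ⟦T⟧ P0 = begin
  suc (# (P ∘ suc))                                        ≤⟨ s≤s (#-injection (P ∘ suc) Q′ (h ∘ suc) P⇒Q′h inj′) ⟩
  suc (# (λ j → Q j ∧ not (does (h zero ≟ᶠ j))))          ≡⟨ #-remove Q (h zero) (P⇒Qh zero P0) ⟩
  # Q                                                      ∎
  where
  open ≤-Reasoning
  Q′ : Fin _ → Bool
  Q′ j = Q j ∧ not (does (h zero ≟ᶠ j))
  inj′ : ∀ i j → T (P (suc i)) → T (P (suc j)) → h (suc i) ≡ h (suc j) → i ≡ j
  inj′ i j Pi Pj = suc-injective ∘ inj (suc i) (suc j) Pi Pj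
  P⇒Q′h : ∀ i → T (P (suc i)) → T (Q′ (h (suc i)))
  P⇒Q′h i Pi with h zero ≟ᶠ h (suc i)
  ... | yes h0≡hi = case inj zero (suc i) P0 Pi h0≡hi of λ ()
  ... | no _ rewrite ∧-identityʳ (Q (h (suc i))) = P⇒Qh (suc i) Pi

module Reachability {n : ℕ} (step : Fin n → Fin n → Bool) (s : Fin n) where

  data Path : Fin n → List (Fin n) → Set where
    start : Path s (s ∷ [])
    snoc : ∀ {a b vs} → Path a vs → T (step a b) → b ∉ vs → Path b (b ∷ vs)

  end∈ : ∀ {a vs} → Path a vs → a ∈ vs
  end∈ start = here refl
  end∈ (snoc _ _ _) = here refl

  Path-ind : (P : Fin n → Set) → P s → (∀ {a b vs} → Path a vs → P a → T (step a b) → P b) →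
    ∀ {a vs} → Path a vs → P a
  Path-ind P Ps P-step start = Ps
  Path-ind P Ps P-step (snoc p st _) = P-step p (Path-ind P Ps P-step p) st

  Closed : (Fin n → Bool) → Set
  Closed R = ∀ a b → T (R a) → T (step a b) → T (R b)

  record Explored (goal R : Fin n → Bool) : Set where
    field
      source : T (R s)
      avoids : ∀ a → T (R a) → ¬ T (goal a)
      reached : ∀ a → T (R a) → Σ (List (Fin n)) λ vs → Path a vs × All (T ∘ R) vs

  SearchResult : (Fin n → Bool) → Set
  SearchResult goal =
    (Σ (Fin n) λ t → Σ (List (Fin n)) λ vs → Path t vs × T (goal t)) ⊎
    (Σ (Fin n → Bool) λ R → Explored goal R × Closed R)

  private
    _∪｛_｝ : (Fin n → Bool) → Fin n → Fin n → Bool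
    (R ∪｛ b ｝) x = R x ∨ does (b ≟ᶠ x)

    ∪-inj₁ : ∀ R b x → T (R x) → T ((R ∪｛ b ｝) x)
    ∪-inj₁ R b x Rx = Equivalence.from T-∨ (inj₁ Rx)

    ∪-new : ∀ R b → T ((R ∪｛ b ｝) b)
    ∪-new R b = Equivalence.from T-∨ (inj₂ (does-complete (b ≟ᶠ b) refl))

    ∪-elim : ∀ R b x → T ((R ∪｛ b ｝) x) → T (R x) ⊎ b ≡ x
    ∪-elim R b x Rbx with Equivalence.to T-∨ Rbx
    ... | inj₁ Rx = inj₁ Rx
    ... | inj₂ b≟x = inj₂ (does-sound (b ≟ᶠ x) b≟x)

    #-∪ : ∀ R b → ¬ T (R b) → # (R ∪｛ b ｝) ≡ suc (# R)
    #-∪ R b ¬Rb = begin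
      # (R ∪｛ b ｝)                    ≡⟨ +-identityʳ _ ⟨
      # (R ∪｛ b ｝) + 0                ≡⟨ cong (λ x → # (R ∪｛ b ｝) + x) (⟦¬T⟧ ¬Rb) ⟨
      # (R ∪｛ b ｝) + ⟦ R b ⟧          ≡⟨ #-update (R ∪｛ b ｝) R b R∪b≐R ⟩
      # R + ⟦ (R ∪｛ b ｝) b ⟧          ≡⟨ cong (λ x → # R + ⟦ x ⟧) (Equivalence.to T-≡ (∪-new R b)) ⟩
      # R + 1                          ≡⟨ +-comm (# R) 1 ⟩
      suc (# R)                        ∎
      where
      open ≡-Reasoning
      R∪b≐R : ∀ x → b ≢ x → (R ∪｛ b ｝) x ≡ R x
      R∪b≐R x b≢x rewrite dec-false (b ≟ᶠ x) b≢x = ∨-identityʳ (R x)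

    explore-edge : ∀ {goal R a b} → Explored goal R → T (R a) → T (step a b) → ¬ T (R b) → ¬ T (goal b) →
      Explored goal (R ∪｛ b ｝)
    explore-edge {goal} {R} {a} {b} E Ra ab ¬Rb ¬goal-b = record
      { source = ∪-inj₁ R b s (source E)
      ; avoids = avoids′
      ; reached = reached′
      }
      where
      open Explored
      avoids′ : ∀ x → T ((R ∪｛ b ｝) x) → ¬ T (goal x)
      avoids′ x Rbx with ∪-elim R b x Rbx
      ... | inj₁ Rx = avoids E x Rx
      ... | inj₂ refl = ¬goal-b
      reached′ : ∀ x → T ((R ∪｛ b ｝) x) → Σ (List (Fin n)) λ vs → Path x vs × All (T ∘ (R ∪｛ b ｝)) vs
      reached′ x Rbx with ∪-elim R b x Rbx
      ... | inj₁ Rx with reached E x Rx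
      ...   | vs , p , Rvs = vs , p , All.map (∪-inj₁ R b _) Rvs
      reached′ x Rbx | inj₂ refl with reached E a Ra
      ...   | vs , p , Rvs = b ∷ vs , snoc p ab (¬Rb ∘ All.lookup Rvs) , ∪-new R b ∷ All.map (∪-inj₁ R b _) Rvs

    search-from : (goal : Fin n → Bool) (fuel : ℕ) (R : Fin n → Bool) → n ≤ # R + fuel → Explored goal R →
      SearchResult goal
    search-from goal fuel R bound E
      with any? (λ a → any? (λ b → T? (R a) ×-dec (T? (step a b) ×-dec ¬? (T? (R b)))))
    ... | no no-exit = inj₂ (R , E , closed)
      where
      closed : Closed R
      closed a b Ra ab with T? (R b)
      ... | yes Rb = Rb
      ... | no ¬Rb = ⊥-elim (no-exit (a , b , Ra , ab , ¬Rb))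
    ... | yes (a , b , Ra , ab , ¬Rb) with T? (goal b)
    ...   | yes goal-b with Explored.reached E a Ra
    ...     | vs , p , Rvs = inj₁ (b , b ∷ vs , snoc p ab (¬Rb ∘ All.lookup Rvs) , goal-b)
    search-from goal zero R bound E | yes (a , b , Ra , ab , ¬Rb) | no ¬goal-b =
      ⊥-elim (<⇒≱ (#-< R b ¬Rb) (subst (n ≤_) (+-identityʳ _) bound))
    search-from goal (suc fuel) R bound E | yes (a , b , Ra , ab , ¬Rb) | no ¬goal-b =
      search-from goal fuel (R ∪｛ b ｝) bound′ (explore-edge E Ra ab ¬Rb ¬goal-b)
      where
      bound′ : n ≤ # (R ∪｛ b ｝) + fuel
      bound′ = subst (n ≤_) (trans (+-suc (# R) fuel) (cong (_+ fuel) (sym (#-∪ R b ¬Rb)))) bound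

  search : (goal : Fin n → Bool) → SearchResult goal
  search goal with T? (goal s)
  ... | yes goal-s = inj₁ (s , s ∷ [] , start , goal-s)
  ... | no ¬goal-s = search-from goal n ｛s｝ (m≤n+m n _) E₀
    where
    ｛s｝ : Fin n → Bool
    ｛s｝ x = does (s ≟ᶠ x)
    s∈｛s｝ : T (｛s｝ s)
    s∈｛s｝ = does-complete (s ≟ᶠ s) refl
    E₀ : Explored goal ｛s｝
    E₀ = record
      { source = s∈｛s｝
      ; avoids = λ a s≡a → case does-sound (s ≟ᶠ a) s≡a of λ { refl → ¬goal-s }
      ; reached = λ a s≡a → case does-sound (s ≟ᶠ a) s≡a of λ { refl → s ∷ [] , start , s∈｛s｝ ∷ [] }
      }

Path-map : ∀ {n} {step step′ : Fin n → Fin n → Bool} {s a vs} → Reachability.Path step s a vs →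
  (∀ x y → x ∈ vs → y ∈ vs → T (step x y) → T (step′ x y)) → Reachability.Path step′ s a vs
Path-map Reachability.start f = Reachability.start
Path-map {step = step} {s = s} (Reachability.snoc {a} {b} p ab b∉vs) f =
  Reachability.snoc (Path-map p (λ x y x∈ y∈ → f x y (there x∈) (there y∈)))
    (f a b (there (Reachability.end∈ step s p)) (here refl) ab) b∉vs

module Bipartite {n : ℕ} (G : Graph n) (D : Subset n) where

  inD : Fin n → Bool
  inD = lookup D

  HEdge : Fin n → Fin n → Set
  HEdge a b = T (adj G a b ∧ (inD a ∧ not (inD b))) ⊎ T (adj G a b ∧ (not (inD a) ∧ inD b))

  HEdge-sides : ∀ {a b} → HEdge a b → inD a ≡ not (inD b)
  HEdge-sides {a} {b} h with adj G a b | inD a | inD b | h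
  ... | false | _ | _ | inj₁ ()
  ... | false | _ | _ | inj₂ ()
  ... | true | true  | false | _ = refl
  ... | true | false | true  | _ = refl
  ... | true | true  | true  | inj₁ ()
  ... | true | true  | true  | inj₂ ()
  ... | true | false | false | inj₁ ()
  ... | true | false | false | inj₂ ()

  HEdge-from-D : ∀ {a b} → HEdge a b → T (inD a) → ¬ T (inD b)
  HEdge-from-D ab Da = T-not⇒¬T (subst T (HEdge-sides ab) Da)

  HEdge-from-X : ∀ {a b} → HEdge a b → ¬ T (inD a) → T (inD b)
  HEdge-from-X ab ¬Da = ¬T-flip (HEdge-sides ab) ¬Da

  HEdge-irrefl : ∀ {a b} → HEdge a b → a ≢ b
  HEdge-irrefl {a} h refl = not-¬ refl (HEdge-sides h)

  HEdge⇒adj : ∀ {a b} → HEdge a b → T (adj G a b)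
  HEdge⇒adj {a} {b} h with adj G a b | h
  ... | true | _ = tt
  ... | false | inj₁ ()
  ... | false | inj₂ ()

  HEdge-intro : ∀ {a b} → T (adj G a b) → inD a ≡ not (inD b) → HEdge a b
  HEdge-intro {a} {b} ab sides with adj G a b | inD a | inD b | sides
  HEdge-intro () _ | false | _ | _ | _
  ... | true | true  | false | _ = inj₁ tt
  ... | true | false | true  | _ = inj₂ tt

  HEdge-sym : ∀ {a b} → HEdge a b → HEdge b a
  HEdge-sym {a} {b} ab = HEdge-intro (subst T (Graph.sym G a b) (HEdge⇒adj ab))
    (trans (sym (not-involutive (inD b))) (cong not (sym (HEdge-sides ab))))

-- c₀ (available as k ≥ 1) is only a junk colour for reading a partial colouring as a total function.
module PartialColouring {n : ℕ} (G : Graph n) (D : Subset n) (k : ℕ) (c₀ : Fin k) where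
  open Bipartite G D public

  Colouring : Set
  Colouring = Fin n → Fin n → Maybe (Fin k)

  support : Colouring → Fin n → Fin n → Bool
  support c a b = is-just (c a b)


  record Proper (c : Colouring) : Set where
    field
      symmetric : ∀ a b → c a b ≡ c b a
      in-H : ∀ a b → T (is-just (c a b)) → HEdge a b
      injective : ∀ a b b′ α → c a b ≡ just α → c a b′ ≡ just α → b ≡ b′
  open Proper public

  empty : Colouring
  empty _ _ = nothing

  empty-proper : Proper empty
  empty-proper = record { symmetric = λ _ _ → refl ; in-H = λ _ _ () ; injective = λ _ _ _ _ () }

  support-⊆H : ∀ {c} → Proper c → IsSubgraphOfH G D (support c)
  support-⊆H {c} pc = (λ a b → cong is-just (symmetric pc a b)) , in-H pc

  support-chromatic : ∀ {c} → Proper c → KEdgeChromatic k (support c)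
  support-chromatic {c} pc = colour , (λ a b _ → cong (fromMaybe c₀) (symmetric pc a b)) , distinct
    where
    colour : Fin n → Fin n → Fin k
    colour a b = fromMaybe c₀ (c a b)
    distinct : ∀ u v w → T (support c u v) → T (support c u w) → v ≢ w → colour u v ≢ colour u w
    distinct u v w _ _ v≢w eq with c u v in cuv | c u w in cuw
    distinct u v w _ _ v≢w refl | just α | just .α = v≢w (injective pc u v w α cuv cuw)

  deg : Colouring → Fin n → ℕ
  deg c v = # (support c v)

  Misses : Colouring → Fin n → Fin k → Set
  Misses c v α = ∀ b → c v b ≢ just α

  deg≤k : ∀ {c} → Proper c → ∀ v → deg c v ≤ k
  deg≤k {c} pc v = subst (deg c v ≤_) (#-true {k})
    (#-injection (λ b → is-just (c v b)) (λ _ → true) (λ b → fromMaybe c₀ (c v b)) (λ _ _ → tt) colour-injective)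
    where
    colour-injective : ∀ i j → T (is-just (c v i)) → T (is-just (c v j)) →
      fromMaybe c₀ (c v i) ≡ fromMaybe c₀ (c v j) → i ≡ j
    colour-injective i j _ _ eq with c v i in ci | c v j in cj
    colour-injective i j _ _ refl | just α | just .α = injective pc v i j α ci cj

  missing-colour : ∀ {c} → Proper c → ∀ v → deg c v < k → Σ (Fin k) (Misses c v)
  missing-colour {c} pc v deg<k with any? (λ α → all? (λ b → ¬? (≡-dec _≟ᶠ_ (c v b) (just α))))
  ... | yes missing = missing
  ... | no ¬missing = ⊥-elim (<⇒≱ deg<k (subst (_≤ deg c v) (#-true {k})
          (#-injection (λ _ → true) (λ b → is-just (c v b)) (proj₁ ∘ edge) (λ α _ → edge-coloured α) edge-injective)))
    where
    edge : ∀ α → Σ (Fin n) λ b → c v b ≡ just α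
    edge α with ¬∀⟶∃¬ n (λ b → c v b ≢ just α) (λ b → ¬? (≡-dec _≟ᶠ_ (c v b) (just α))) (¬missing ∘ (α ,_))
    ... | b , ¬¬cvb = b , decidable-stable (≡-dec _≟ᶠ_ (c v b) (just α)) ¬¬cvb
    edge-coloured : ∀ α → T (is-just (c v (proj₁ (edge α))))
    edge-coloured α rewrite proj₂ (edge α) = tt
    edge-injective : ∀ α β → T true → T true → proj₁ (edge α) ≡ proj₁ (edge β) → α ≡ β
    edge-injective α β _ _ eq = just-injective (trans (sym (proj₂ (edge α))) (trans (cong (c v) eq) (proj₂ (edge β))))

  SameEdge : Fin n → Fin n → Fin n → Fin n → Set
  SameEdge x t a b = (a ≡ x × b ≡ t) ⊎ (a ≡ t × b ≡ x)

  SameEdge? : ∀ x t a b → Dec (SameEdge x t a b)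
  SameEdge? x t a b = ((a ≟ᶠ x) ×-dec (b ≟ᶠ t)) ⊎-dec ((a ≟ᶠ t) ×-dec (b ≟ᶠ x))

  SameEdge-sym : ∀ {x t a b} → SameEdge x t a b → SameEdge x t b a
  SameEdge-sym (inj₁ (a≡x , b≡t)) = inj₂ (b≡t , a≡x)
  SameEdge-sym (inj₂ (a≡t , b≡x)) = inj₁ (b≡x , a≡t)

  SameEdge-flip : ∀ {x t a b} → SameEdge x t a b → SameEdge t x a b
  SameEdge-flip (inj₁ (a≡x , b≡t)) = inj₂ (a≡x , b≡t)
  SameEdge-flip (inj₂ (a≡t , b≡x)) = inj₁ (a≡t , b≡x)

  AgreeOff : Fin n → Fin n → Colouring → Colouring → Set
  AgreeOff x t c c′ = ∀ a b → ¬ SameEdge x t a b → is-just (c′ a b) ≡ is-just (c a b)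

  AgreeOff-sym : ∀ {x t c c′} → AgreeOff x t c c′ → AgreeOff x t c′ c
  AgreeOff-sym agree a b ¬xt = sym (agree a b ¬xt)

  AgreeOff-flip : ∀ {x t c c′} → AgreeOff x t c c′ → AgreeOff t x c c′
  AgreeOff-flip agree a b ¬tx = agree a b (¬tx ∘ SameEdge-flip)

  deg-away : ∀ {x t c c′ v} → AgreeOff x t c c′ → v ≢ x → v ≢ t → deg c′ v ≡ deg c v
  deg-away {v = v} agree v≢x v≢t =
    #-cong λ b → agree v b λ { (inj₁ (v≡x , _)) → v≢x v≡x ; (inj₂ (v≡t , _)) → v≢t v≡t }

  deg-at : ∀ {x t c c′} → AgreeOff x t c c′ → x ≢ t → ¬ T (is-just (c x t)) → T (is-just (c′ x t)) →
    deg c′ x ≡ suc (deg c x)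
  deg-at {x} {t} {c} {c′} agree x≢t before after = begin
    deg c′ x                               ≡⟨ +-identityʳ _ ⟨
    deg c′ x + 0                           ≡⟨ cong (deg c′ x +_) (⟦¬T⟧ before) ⟨
    deg c′ x + ⟦ is-just (c x t) ⟧         ≡⟨ #-update (λ b → is-just (c′ x b)) (λ b → is-just (c x b)) t agree-at-x ⟩
    deg c x + ⟦ is-just (c′ x t) ⟧         ≡⟨ cong (deg c x +_) (⟦T⟧ after) ⟩
    deg c x + 1                            ≡⟨ +-comm _ 1 ⟩
    suc (deg c x)                          ∎
    where
    open ≡-Reasoning
    agree-at-x : ∀ b → t ≢ b → is-just (c′ x b) ≡ is-just (c x b)
    agree-at-x b t≢b = agree x b λ { (inj₁ (_ , b≡t)) → t≢b (sym b≡t) ; (inj₂ (x≡t , _)) → x≢t x≡t }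

  recolour : Colouring → Fin n → Fin n → Maybe (Fin k) → Colouring
  recolour c x t m a b with SameEdge? x t a b
  ... | yes _ = m
  ... | no _ = c a b

  recolour-other : ∀ c x t m a b → ¬ SameEdge x t a b → recolour c x t m a b ≡ c a b
  recolour-other c x t m a b ¬xt with SameEdge? x t a b
  ... | yes xt = ⊥-elim (¬xt xt)
  ... | no _ = refl

  recolour-this : ∀ c x t m a b → SameEdge x t a b → recolour c x t m a b ≡ m
  recolour-this c x t m a b xt with SameEdge? x t a b
  ... | yes _ = refl
  ... | no ¬xt = ⊥-elim (¬xt xt)

  recolour-agrees : ∀ c x t m → AgreeOff x t c (recolour c x t m)
  recolour-agrees c x t m a b ¬xt = cong is-just (recolour-other c x t m a b ¬xt)

  recolour-symmetric : ∀ {c} x t m → Proper c → ∀ a b → recolour c x t m a b ≡ recolour c x t m b a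
  recolour-symmetric {c} x t m pc a b with SameEdge? x t a b | SameEdge? x t b a
  ... | yes _  | yes _  = refl
  ... | yes xt | no ¬xt = ⊥-elim (¬xt (SameEdge-sym xt))
  ... | no ¬xt | yes xt = ⊥-elim (¬xt (SameEdge-sym xt))
  ... | no _   | no _   = symmetric pc a b

  uncolour-proper : ∀ {c} x t → Proper c → Proper (recolour c x t nothing)
  uncolour-proper {c} x t pc = record
    { symmetric = recolour-symmetric x t nothing pc
    ; in-H = in-H′
    ; injective = injective′
    }
    where
    in-H′ : ∀ a b → T (is-just (recolour c x t nothing a b)) → HEdge a b
    in-H′ a b coloured with SameEdge? x t a b
    ... | no _ = in-H pc a b coloured
    injective′ : ∀ a b b′ α → recolour c x t nothing a b ≡ just α → recolour c x t nothing a b′ ≡ just α → b ≡ b′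
    injective′ a b b′ α cab cab′ with SameEdge? x t a b | SameEdge? x t a b′
    ... | no _ | no _ = injective pc a b b′ α cab cab′

  deg-uncolour : ∀ {c x t v w} → Proper c → T (is-just (c x t)) → SameEdge x t v w →
    deg c v ≡ suc (deg (recolour c x t nothing) v)
  deg-uncolour {c} {x} {t} pc coloured (inj₁ (refl , refl)) =
    deg-at (AgreeOff-sym (recolour-agrees c x t nothing)) (HEdge-irrefl (in-H pc x t coloured))
      (subst (T ∘ is-just) (recolour-this c x t nothing x t (inj₁ (refl , refl)))) coloured
  deg-uncolour {c} {x} {t} pc coloured (inj₂ (refl , refl)) =
    deg-at (AgreeOff-flip (AgreeOff-sym (recolour-agrees c x t nothing))) (HEdge-irrefl (in-H pc t x coloured′))
      (subst (T ∘ is-just) (recolour-this c x t nothing t x (inj₂ (refl , refl)))) coloured′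
    where
    coloured′ : T (is-just (c t x))
    coloured′ = subst (T ∘ is-just) (symmetric pc x t) coloured

  colour-proper : ∀ {c x t γ} → Proper c → HEdge x t → Misses c x γ → Misses c t γ → Proper (recolour c x t (just γ))
  colour-proper {c} {x} {t} {γ} pc xt x-misses t-misses = record
    { symmetric = recolour-symmetric x t (just γ) pc
    ; in-H = in-H′
    ; injective = injective′
    }
    where
    in-H′ : ∀ a b → T (is-just (recolour c x t (just γ) a b)) → HEdge a b
    in-H′ a b coloured with SameEdge? x t a b
    ... | yes (inj₁ (refl , refl)) = xt
    ... | yes (inj₂ (refl , refl)) = HEdge-sym xt
    ... | no _ = in-H pc a b coloured
    injective′ : ∀ a b b′ α →
      recolour c x t (just γ) a b ≡ just α → recolour c x t (just γ) a b′ ≡ just α → b ≡ b′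
    injective′ a b b′ α cab cab′ with SameEdge? x t a b | SameEdge? x t a b′
    ... | yes (inj₁ (refl , refl)) | yes (inj₁ (_ , refl)) = refl
    ... | yes (inj₂ (refl , refl)) | yes (inj₂ (_ , refl)) = refl
    ... | yes (inj₁ (refl , refl)) | yes (inj₂ (a≡t , _)) = ⊥-elim (HEdge-irrefl xt a≡t)
    ... | yes (inj₂ (refl , refl)) | yes (inj₁ (a≡x , _)) = ⊥-elim (HEdge-irrefl xt (sym a≡x))
    injective′ a b b′ α refl cab′ | yes (inj₁ (refl , refl)) | no _ = ⊥-elim (x-misses b′ cab′)
    injective′ a b b′ α refl cab′ | yes (inj₂ (refl , refl)) | no _ = ⊥-elim (t-misses b′ cab′)
    injective′ a b b′ α cab refl  | no _ | yes (inj₁ (refl , refl)) = ⊥-elim (x-misses b cab)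
    injective′ a b b′ α cab refl  | no _ | yes (inj₂ (refl , refl)) = ⊥-elim (t-misses b cab)
    ... | no _ | no _ = injective pc a b b′ α cab cab′

  ColouredIn : Colouring → Fin k → Fin k → Fin n → Fin n → Set
  ColouredIn c β γ a b = c a b ≡ just β ⊎ c a b ≡ just γ

  swap-within : (Fin n → Bool) → Fin k → Fin k → Colouring → Colouring
  swap-within R β γ c a b = if R a then Maybe.map (transpose β γ) (c a b) else c a b

  swap-within-support : ∀ R β γ c a b → is-just (swap-within R β γ c a b) ≡ is-just (c a b)
  swap-within-support R β γ c a b with R a | c a b
  ... | true  | just _  = refl
  ... | true  | nothing = refl
  ... | false | _       = refl

  swap-within-outside : ∀ R β γ c a b → ¬ T (R a) → swap-within R β γ c a b ≡ c a b
  swap-within-outside R β γ c a b ¬Ra with R a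
  ... | true = ⊥-elim (¬Ra tt)
  ... | false = refl

  swap-within-inside : ∀ R β γ c a b → T (R a) → swap-within R β γ c a b ≡ Maybe.map (transpose β γ) (c a b)
  swap-within-inside R β γ c a b Ra with R a
  ... | true = refl

  private
    transpose-self : ∀ (β γ : Fin k) → transpose β γ β ≡ γ
    transpose-self β γ with β ≟ᶠ β
    ... | yes _ = refl
    ... | no β≢β = ⊥-elim (β≢β refl)

    transpose-other : ∀ {β γ α : Fin k} → α ≢ β → α ≢ γ → transpose β γ α ≡ α
    transpose-other {β} {γ} {α} α≢β α≢γ with α ≟ᶠ β
    ... | yes α≡β = ⊥-elim (α≢β α≡β)
    ... | no _ with α ≟ᶠ γ
    ...   | yes α≡γ = ⊥-elim (α≢γ α≡γ)
    ...   | no _ = refl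

    map-transpose⁻¹ : ∀ (β γ : Fin k) m α → Maybe.map (transpose β γ) m ≡ just α → m ≡ just (transpose γ β α)
    map-transpose⁻¹ β γ (just α₀) α eq =
      cong just (trans (sym (transpose-inverse γ β)) (cong (transpose γ β) (just-injective eq)))

  swap-within-proper : ∀ {c} R β γ → Proper c → (∀ a b → T (R a) → ColouredIn c β γ a b → T (R b)) →
    Proper (swap-within R β γ c)
  swap-within-proper {c} R β γ pc closed = record
    { symmetric = symmetric′
    ; in-H = λ a b coloured → in-H pc a b (subst T (swap-within-support R β γ c a b) coloured)
    ; injective = injective′
    }
    where
    fixed-on-exit : ∀ a b → T (R a) → ¬ T (R b) → Maybe.map (transpose β γ) (c a b) ≡ c a b
    fixed-on-exit a b Ra ¬Rb with c a b in cab
    ... | nothing = refl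
    ... | just α = cong just (transpose-other (λ { refl → ¬Rb (closed a b Ra (inj₁ cab)) })
                                              (λ { refl → ¬Rb (closed a b Ra (inj₂ cab)) }))
    symmetric′ : ∀ a b → swap-within R β γ c a b ≡ swap-within R β γ c b a
    symmetric′ a b with R a in Ra | R b in Rb
    ... | true  | true  = cong (Maybe.map (transpose β γ)) (symmetric pc a b)
    ... | false | false = symmetric pc a b
    ... | true  | false = trans (fixed-on-exit a b (Equivalence.from T-≡ Ra) (subst T Rb)) (symmetric pc a b)
    ... | false | true  = trans (symmetric pc a b) (sym (fixed-on-exit b a (Equivalence.from T-≡ Rb) (subst T Ra)))
    injective′ : ∀ a b b′ α → swap-within R β γ c a b ≡ just α → swap-within R β γ c a b′ ≡ just α → b ≡ b′
    injective′ a b b′ α cab cab′ with R a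
    ... | true  = injective pc a b b′ (transpose γ β α) (map-transpose⁻¹ β γ _ α cab) (map-transpose⁻¹ β γ _ α cab′)
    ... | false = injective pc a b b′ α cab cab′

  -- The β/γ Kempe chain at t: from t's side of H follow γ-edges, from the far side β-edges.
  kempe-chain : ∀ {c x t β γ} → Proper c → HEdge x t → Misses c x γ → Misses c t β →
    Σ (Fin n → Bool) λ R → T (R t) × ¬ T (R x) × (∀ a b → T (R a) → ColouredIn c β γ a b → T (R b))
  kempe-chain {c} {x} {t} {β} {γ} pc xt x-misses t-misses = chain (search (λ _ → false))
    where
    far : Fin n → Bool
    far a = inD a xor inD t

    far-flip : ∀ {a b} → HEdge a b → far a ≡ not (far b)
    far-flip {a} {b} ab = trans (cong (_xor inD t) (HEdge-sides ab)) (sym (not-distribˡ-xor (inD b) (inD t)))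

    t-near : ¬ T (far t)
    t-near = subst T (xor-same (inD t))

    is : Fin k → Fin n → Fin n → Bool
    is α a b = does (≡-dec _≟ᶠ_ (c a b) (just α))

    step : Fin n → Fin n → Bool
    step a b = if far a then is β a b else is γ a b

    step-far : ∀ {a b} → T (far a) → c a b ≡ just β → T (step a b)
    step-far {a} {b} fa cab with far a
    ... | true = does-complete (≡-dec _≟ᶠ_ (c a b) (just β)) cab

    step-near : ∀ {a b} → ¬ T (far a) → c a b ≡ just γ → T (step a b)
    step-near {a} {b} ¬fa cab with far a
    ... | true = ⊥-elim (¬fa tt)
    ... | false = does-complete (≡-dec _≟ᶠ_ (c a b) (just γ)) cab

    step-inv : ∀ a b → T (step a b) → (T (far a) × c a b ≡ just β) ⊎ (¬ T (far a) × c a b ≡ just γ)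
    step-inv a b ab with far a
    ... | true = inj₁ (tt , does-sound (≡-dec _≟ᶠ_ (c a b) (just β)) ab)
    ... | false = inj₂ ((λ ()) , does-sound (≡-dec _≟ᶠ_ (c a b) (just γ)) ab)

    open Reachability step t

    chain : SearchResult (λ _ → false) →
      Σ (Fin n → Bool) λ R → T (R t) × ¬ T (R x) × (∀ a b → T (R a) → ColouredIn c β γ a b → T (R b))
    chain (inj₁ (_ , _ , _ , ()))
    chain (inj₂ (R , explored , closed)) = R , source , x∉R , closed-βγ
      where
      open Explored explored

      coloured-edge : ∀ {a b α} → c a b ≡ just α → HEdge a b
      coloured-edge {a} {b} cab = in-H pc a b (subst (T ∘ is-just) (sym cab) tt)

      in-R : ∀ {a vs} → Path a vs → T (R a)
      in-R = Path-ind (T ∘ R) source (λ _ Ra ab → closed _ _ Ra ab)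

      -- the edge along which a was reached: γ into the far side, β into t's side (or a = t)
      Entered : Fin n → Set
      Entered a = (T (far a) → Σ (Fin n) λ b → T (R b) × c a b ≡ just γ) ×
                  (¬ T (far a) → a ≡ t ⊎ Σ (Fin n) λ b → T (R b) × c a b ≡ just β)

      entered : ∀ {a vs} → Path a vs → Entered a
      entered = Path-ind Entered (⊥-elim ∘ t-near , λ _ → inj₁ refl) entered-step
        where
        entered-step : ∀ {a b vs} → Path a vs → Entered a → T (step a b) → Entered b
        entered-step {a} {b} p _ ab with step-inv a b ab
        ... | inj₁ (fa , cab) =
          (λ fb → ⊥-elim (T-not⇒¬T (subst T (far-flip (coloured-edge cab)) fa) fb)) ,
          (λ _ → inj₂ (a , in-R p , trans (symmetric pc b a) cab))
        ... | inj₂ (¬fa , cab) =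
          (λ _ → a , in-R p , trans (symmetric pc b a) cab) ,
          (λ ¬fb → ⊥-elim (¬fb (¬T-flip (far-flip (coloured-edge cab)) ¬fa)))

      x∉R : ¬ T (R x)
      x∉R Rx with reached x Rx
      ... | _ , p , _ = let (b , _ , cxb) = proj₁ (entered p) x-far in x-misses b cxb
        where
        x-far : T (far x)
        x-far = ¬T-flip (far-flip (HEdge-sym xt)) t-near

      closed-βγ : ∀ a b → T (R a) → ColouredIn c β γ a b → T (R b)
      closed-βγ a b Ra cab with reached a Ra | T? (far a) | cab
      ... | _ | yes fa | inj₁ cab≡β = closed a b Ra (step-far fa cab≡β)
      ... | _ | no ¬fa | inj₂ cab≡γ = closed a b Ra (step-near ¬fa cab≡γ)
      ... | _ , p , _ | yes fa | inj₂ cab≡γ with proj₁ (entered p) fa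
      ...   | b′ , Rb′ , cab′ = subst (T ∘ R) (injective pc a b′ b γ cab′ cab≡γ) Rb′
      closed-βγ a b Ra cab | _ , p , _ | no ¬fa | inj₁ cab≡β with proj₂ (entered p) ¬fa
      ...   | inj₁ refl = ⊥-elim (t-misses b cab≡β)
      ...   | inj₂ (b′ , Rb′ , cab′) = subst (T ∘ R) (injective pc a b′ b β cab′ cab≡β) Rb′

  kempe-swap : ∀ {c x t β γ} → Proper c → HEdge x t → Misses c x γ → Misses c t β →
    Σ Colouring λ c′ → Proper c′ × (∀ a b → is-just (c′ a b) ≡ is-just (c a b)) × Misses c′ x γ × Misses c′ t γ
  kempe-swap {c} {x} {t} {β} {γ} pc xt x-misses t-misses with kempe-chain pc xt x-misses t-misses
  ... | R , Rt , ¬Rx , closed =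
    swap-within R β γ c , swap-within-proper R β γ pc closed , swap-within-support R β γ c ,
    (λ b c′xb → x-misses b (trans (sym (swap-within-outside R β γ c x b ¬Rx)) c′xb)) ,
    (λ b c′tb → t-misses b (trans (map-transpose⁻¹ β γ (c t b) γ (trans (sym (swap-within-inside R β γ c t b Rt)) c′tb))
                                  (cong just (transpose-self γ β))))

  -- König's argument: after a Kempe swap the colour missing at x is missing at t as well.
  extend : ∀ {c x t} → Proper c → HEdge x t → deg c x < k → deg c t < k →
    Σ Colouring λ c′ → Proper c′ × AgreeOff x t c c′ × T (is-just (c′ x t))
  extend {c} {x} {t} pc xt x-free t-free with missing-colour pc x x-free | missing-colour pc t t-free
  ... | γ , x-misses | β , t-misses with kempe-swap pc xt x-misses t-misses
  ... | c₁ , pc₁ , same-support , x-misses₁ , t-misses₁ =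
    recolour c₁ x t (just γ) , colour-proper pc₁ xt x-misses₁ t-misses₁ ,
    (λ a b ¬xt → trans (recolour-agrees c₁ x t (just γ) a b ¬xt) (same-support a b)) ,
    subst (T ∘ is-just) (sym (recolour-this c₁ x t (just γ) x t (inj₁ (refl , refl)))) tt

module Augmenting {n : ℕ} (G : Graph n) (D : Subset n) (k : ℕ) (c₀ : Fin k) where
  open PartialColouring G D k c₀ public

  -- Alternating steps: from X along an uncoloured H-edge, from D along a coloured edge.
  alternating : Colouring → Fin n → Fin n → Bool
  alternating c a b = adj G a b ∧ (if inD a then is-just (c a b) else (inD b ∧ not (is-just (c a b))))

  alternating-from-X : ∀ {c a b} → ¬ T (inD a) → T (alternating c a b) → HEdge a b × ¬ T (is-just (c a b))
  alternating-from-X {c} {a} {b} ¬Da ab with adj G a b | inD a | inD b | is-just (c a b)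
  ... | true  | false | true  | false = inj₂ tt , λ ()
  ... | _     | true  | _     | _     = ⊥-elim (¬Da tt)
  alternating-from-X _ () | false | false | _ | _
  alternating-from-X _ () | true  | false | false | _
  alternating-from-X _ () | true  | false | true  | true

  alternating-from-D : ∀ {c a b} → T (inD a) → T (alternating c a b) → T (is-just (c a b))
  alternating-from-D {c} {a} {b} Da ab with adj G a b | inD a
  ... | true  | true  = ab
  ... | _     | false = ⊥-elim Da
  alternating-from-D _ () | false | true

  alternating-intro-X : ∀ {c a b} → ¬ T (inD a) → T (inD b) → T (adj G a b) → ¬ T (is-just (c a b)) →
    T (alternating c a b)
  alternating-intro-X {c} {a} {b} ¬Da Db ab ¬coloured with adj G a b | inD a | inD b | is-just (c a b)
  ... | true | false | true | false = tt
  ... | _    | true  | _    | _     = ⊥-elim (¬Da tt)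
  ... | _    | _     | _    | true  = ⊥-elim (¬coloured tt)

  alternating-intro-D : ∀ {c a b} → Proper c → T (inD a) → T (is-just (c a b)) → T (alternating c a b)
  alternating-intro-D {c} {a} {b} pc Da coloured with adj G a b | HEdge⇒adj (in-H pc a b coloured) | inD a
  ... | true | _ | true = coloured
  ... | true | _ | false = ⊥-elim Da

  alternating-cong : ∀ {c c′ a b} → is-just (c′ a b) ≡ is-just (c a b) → alternating c a b ≡ alternating c′ a b
  alternating-cong eq rewrite eq = refl

  PreservesX : Fin n → Colouring → Colouring → Set
  PreservesX v₀ c c′ = ∀ v → ¬ T (inD v) → v ≢ v₀ → deg c′ v ≡ deg c v

  private
    sides-≢ : ∀ {a b} → T (inD a) → ¬ T (inD b) → a ≢ b
    sides-≢ Da ¬Db refl = ¬Db Da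

  -- Trade the coloured edge ba for the uncoloured edge at: only b loses an edge.
  rotate : ∀ {c a b t} → Proper c → T (inD b) → T (inD t) → b ≢ t →
    T (is-just (c b a)) → HEdge a t → ¬ T (is-just (c a t)) → deg c t < k →
    Σ Colouring λ c′ → Proper c′ × deg c′ b < k × (∀ v → ¬ T (inD v) → deg c′ v ≡ deg c v) ×
      (∀ u w → u ≢ a → w ≢ a → is-just (c′ u w) ≡ is-just (c u w))
  rotate {c} {a} {b} {t} pc Db Dt b≢t ba-coloured at ¬at-coloured t-free =
    c₂ , pc₂ , b-free , X-preserved , agree-off-a
    where
    ba : HEdge b a
    ba = in-H pc b a ba-coloured
    b≢a : b ≢ a
    b≢a = HEdge-irrefl ba
    a≢t : a ≢ t
    a≢t = HEdge-irrefl at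
    c₁ : Colouring
    c₁ = recolour c b a nothing
    agree₁ : AgreeOff b a c c₁
    agree₁ = recolour-agrees c b a nothing
    deg-b₁ : deg c b ≡ suc (deg c₁ b)
    deg-b₁ = deg-uncolour pc ba-coloured (inj₁ (refl , refl))
    deg-a₁ : deg c a ≡ suc (deg c₁ a)
    deg-a₁ = deg-uncolour pc ba-coloured (inj₂ (refl , refl))
    extended = extend (uncolour-proper b a pc) at (subst (_≤ k) deg-a₁ (deg≤k pc a))
                 (subst (_< k) (sym (deg-away agree₁ (b≢t ∘ sym) (a≢t ∘ sym))) t-free)
    c₂ : Colouring
    c₂ = proj₁ extended
    pc₂ : Proper c₂
    pc₂ = proj₁ (proj₂ extended)
    agree₂ : AgreeOff a t c₁ c₂
    agree₂ = proj₁ (proj₂ (proj₂ extended))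
    ¬at-coloured₁ : ¬ T (is-just (c₁ a t))
    ¬at-coloured₁ = subst (¬_ ∘ T)
      (sym (agree₁ a t λ { (inj₁ (a≡b , _)) → b≢a (sym a≡b) ; (inj₂ (_ , t≡b)) → b≢t (sym t≡b) }))
      ¬at-coloured
    b-free : deg c₂ b < k
    b-free = subst (_< k) (sym (deg-away agree₂ b≢a b≢t)) (subst (_≤ k) deg-b₁ (deg≤k pc b))
    X-preserved : ∀ v → ¬ T (inD v) → deg c₂ v ≡ deg c v
    X-preserved v ¬Dv = case v ≟ᶠ a of λ
      { (yes refl) → trans (deg-at agree₂ a≢t ¬at-coloured₁ (proj₂ (proj₂ (proj₂ extended)))) (sym deg-a₁)
      ; (no v≢a) → trans (deg-away agree₂ v≢a (sides-≢ Dt ¬Dv ∘ sym)) (deg-away agree₁ (sides-≢ Db ¬Dv ∘ sym) v≢a)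
      }
    agree-off-a : ∀ u w → u ≢ a → w ≢ a → is-just (c₂ u w) ≡ is-just (c u w)
    agree-off-a u w u≢a w≢a = trans (agree₂ u w λ { (inj₁ (u≡a , _)) → u≢a u≡a ; (inj₂ (_ , w≡a)) → w≢a w≡a })
                                    (agree₁ u w λ { (inj₁ (_ , w≡a)) → w≢a w≡a ; (inj₂ (u≡a , _)) → u≢a u≡a })

  Augmented : Fin n → Colouring → Set
  Augmented v₀ c = Σ Colouring λ c′ → Proper c′ × deg c′ v₀ ≡ suc (deg c v₀) × PreservesX v₀ c c′

  augment-edge : ∀ {c v₀ t} → Proper c → ¬ T (inD v₀) → T (inD t) → T (alternating c v₀ t) →
    deg c v₀ < k → deg c t < k → Augmented v₀ c
  augment-edge {c} {v₀} {t} pc ¬Dv₀ Dt v₀t v₀-free t-free with alternating-from-X {c} ¬Dv₀ v₀t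
  ... | v₀t′ , ¬coloured with extend pc v₀t′ v₀-free t-free
  ...   | c′ , pc′ , agree , coloured =
    c′ , pc′ , deg-at agree (HEdge-irrefl v₀t′) ¬coloured coloured ,
    λ v ¬Dv v≢v₀ → deg-away agree v≢v₀ (sides-≢ Dt ¬Dv ∘ sym)

  -- Walking back from t, each D-vertex b on the path gives up its coloured edge to the next vertex a ∈ X,
  -- which takes the uncoloured edge towards t instead; finally v₀ gains an edge.
  augment : (fuel : ℕ) → ∀ {c v₀ t vs} → length vs ≤ fuel → Proper c →
    Reachability.Path (alternating c) v₀ t vs → T (inD t) → deg c t < k → ¬ T (inD v₀) → deg c v₀ < k →
    Augmented v₀ c
  augment fuel len pc Reachability.start Dt _ ¬Dv₀ _ = ⊥-elim (¬Dv₀ Dt)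
  augment fuel {c} {v₀} {t} len pc (Reachability.snoc {a} p at t∉vs) Dt t-free ¬Dv₀ v₀-free with T? (inD a)
  ... | yes Da = ⊥-elim (HEdge-from-D (in-H pc a t (alternating-from-D {c} Da at)) Da Dt)
  augment fuel len pc (Reachability.snoc Reachability.start v₀t _) Dt t-free ¬Dv₀ v₀-free | no _ =
    augment-edge pc ¬Dv₀ Dt v₀t v₀-free t-free
  augment (suc (suc fuel)) {c} {v₀} {t} (s≤s (s≤s len)) pc
    (Reachability.snoc {a} (Reachability.snoc {b} {vs = vs} p ba a∉vs) at t∉vs) Dt t-free ¬Dv₀ v₀-free | no ¬Da
    with alternating-from-X {c} ¬Da at | T? (inD b)
  ... | _ | no ¬Db = ⊥-elim (¬Da (HEdge-from-X (proj₁ (alternating-from-X {c} ¬Db ba)) ¬Db))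
  ... | at′ , ¬at-coloured | yes Db
    with rotate pc Db Dt b≢t (alternating-from-D {c} Db ba) at′ ¬at-coloured t-free
    where
    b≢t : b ≢ t
    b≢t refl = t∉vs (there (Reachability.end∈ (alternating c) v₀ p))
  ... | c₂ , pc₂ , b-free , X-preserved₂ , agree-off-a =
    let c₃ , pc₃ , deg-v₀ , X-preserved₃ = augment fuel len pc₂ (Path-map p path-step) Db b-free ¬Dv₀
                                             (subst (_< k) (sym (X-preserved₂ v₀ ¬Dv₀)) v₀-free)
    in c₃ , pc₃ , trans deg-v₀ (cong suc (X-preserved₂ v₀ ¬Dv₀)) ,
       λ v ¬Dv v≢v₀ → trans (X-preserved₃ v ¬Dv v≢v₀) (X-preserved₂ v ¬Dv)
    where
    path-step : ∀ x y → x ∈ vs → y ∈ vs → T (alternating c x y) → T (alternating c₂ x y)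
    path-step x y x∈vs y∈vs =
      subst T (alternating-cong {c} {c₂} (agree-off-a x y (λ { refl → a∉vs x∈vs }) (λ { refl → a∉vs y∈vs })))

module EdgeForm {n : ℕ} (G : Graph n) where

  Adj : Fin n → Fin n → ℕ
  Adj v u = ⟦ adj G v u ⟧

  -- For indicators p = q = 𝟙 P this is 2|E(G[P])|.
  ⟪_,_⟫ : (Fin n → ℕ) → (Fin n → ℕ) → ℕ
  ⟪ p , q ⟫ = sum (λ v → p v * sum (λ u → q u * Adj v u))

  ⟪⟫-cong : ∀ {p p′ q q′} → (∀ v → p v ≡ p′ v) → (∀ v → q v ≡ q′ v) → ⟪ p , q ⟫ ≡ ⟪ p′ , q′ ⟫
  ⟪⟫-cong p≗p′ q≗q′ = sum-cong-≗ (λ v → cong₂ _*_ (p≗p′ v) (sum-cong-≗ (λ u → cong (_* Adj v u) (q≗q′ u))))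

  ⟪⟫-mono : ∀ {p p′ q q′} → (∀ v → p v ≤ p′ v) → (∀ v → q v ≤ q′ v) → ⟪ p , q ⟫ ≤ ⟪ p′ , q′ ⟫
  ⟪⟫-mono p≤p′ q≤q′ =
    sum-mono-≤ (λ v → *-mono-≤ (p≤p′ v) (sum-mono-≤ (λ u → *-monoˡ-≤ (Adj v u) (q≤q′ u))))

  ⟪⟫-+ˡ : ∀ p p′ q → ⟪ (λ v → p v + p′ v) , q ⟫ ≡ ⟪ p , q ⟫ + ⟪ p′ , q ⟫
  ⟪⟫-+ˡ p p′ q = trans (sum-cong-≗ (λ v → *-distribʳ-+ (sum (λ u → q u * Adj v u)) (p v) (p′ v)))
    (∑-distrib-+ (λ v → p v * sum (λ u → q u * Adj v u)) (λ v → p′ v * sum (λ u → q u * Adj v u)))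

  ⟪⟫-+ʳ : ∀ p q q′ → ⟪ p , (λ v → q v + q′ v) ⟫ ≡ ⟪ p , q ⟫ + ⟪ p , q′ ⟫
  ⟪⟫-+ʳ p q q′ = trans (sum-cong-≗ λ v → trans
      (cong (p v *_) (trans (sum-cong-≗ (λ u → *-distribʳ-+ (Adj v u) (q u) (q′ u)))
                                  (∑-distrib-+ (λ u → q u * Adj v u) (λ u → q′ u * Adj v u))))
      (*-distribˡ-+ (p v) _ _))
    (∑-distrib-+ (λ v → p v * sum (λ u → q u * Adj v u)) (λ v → p v * sum (λ u → q′ u * Adj v u)))

  ⟪⟫-expand : ∀ p q → ⟪ p , q ⟫ ≡ sum (λ v → sum (λ u → p v * (q u * Adj v u)))
  ⟪⟫-expand p q = sum-cong-≗ (λ v → *-distribˡ-sum (p v) (λ u → q u * Adj v u))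

  ⟪⟫-comm : ∀ p q → ⟪ p , q ⟫ ≡ ⟪ q , p ⟫
  ⟪⟫-comm p q = begin
    ⟪ p , q ⟫                                          ≡⟨ ⟪⟫-expand p q ⟩
    sum (λ v → sum (λ u → p v * (q u * Adj v u)))        ≡⟨ sum-cong-≗ (λ v → sum-cong-≗ (λ u → swap v u)) ⟩
    sum (λ v → sum (λ u → q u * (p v * Adj u v)))        ≡⟨ ∑-comm (λ v u → q u * (p v * Adj u v)) ⟩
    sum (λ u → sum (λ v → q u * (p v * Adj u v)))        ≡⟨ ⟪⟫-expand q p ⟨
    ⟪ q , p ⟫                                          ∎
    where
    open ≡-Reasoning
    swap : ∀ v u → p v * (q u * Adj v u) ≡ q u * (p v * Adj u v)
    swap v u rewrite cong ⟦_⟧ (Graph.sym G v u) = solve 3 (λ a b c → a :* (b :* c) := b :* (a :* c)) refl (p v) (q u) (Adj u v)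
      where open +-*-Solver using (solve; _:*_; _:=_)

  ⟪δ,⟫ : ∀ v q → ⟪ δ v , q ⟫ ≡ sum (λ u → q u * Adj v u)
  ⟪δ,⟫ v q = sum-δ v (λ w → sum (λ u → q u * Adj w u))

  ⟪δ,δ⟫ : ∀ v → ⟪ δ v , δ v ⟫ ≡ 0
  ⟪δ,δ⟫ v = trans (⟪δ,⟫ v (δ v)) (trans (sum-δ v (Adj v)) (cong ⟦_⟧ (Graph.irrefl G v)))

  𝟙 : Subset n → Fin n → ℕ
  𝟙 P v = ⟦ lookup P v ⟧

  size : Subset n → ℕ
  size P = # (lookup P)

  ∣∣≡size : ∀ P → ∣ P ∣ ≡ size P
  ∣∣≡size P = trans (cong ∣_∣ (sym (tabulate∘lookup P))) (count≡# (lookup P))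

  degIn≡ : ∀ P v → degIn G P v ≡ sum (λ u → 𝟙 P u * Adj v u)
  degIn≡ P v = trans (count≡# (λ u → lookup P u ∧ adj G v u)) (sum-cong-≗ (λ u → ⟦⟧-∧ (lookup P u) (adj G v u)))

  2|E| : Subset n → ℕ
  2|E| P = ⟪ 𝟙 P , 𝟙 P ⟫

  private
    <ᵇ-flip : ∀ {u w : Fin n} → u ≢ w → (toℕ u <ᵇ toℕ w) ≡ not (toℕ w <ᵇ toℕ u)
    <ᵇ-flip {u} {w} u≢w with toℕ u <ᵇ toℕ w in uw | toℕ w <ᵇ toℕ u in wu
    ... | true  | false = refl
    ... | false | true  = refl
    ... | true  | true  =
      ⊥-elim (<-asym (<ᵇ⇒< (toℕ u) (toℕ w) (subst T (sym uw) tt)) (<ᵇ⇒< (toℕ w) (toℕ u) (subst T (sym wu) tt)))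
    ... | false | false =
      ⊥-elim (u≢w (toℕ-injective (≤-antisym (≮⇒≥ (subst T wu ∘ <⇒<ᵇ)) (≮⇒≥ (subst T uw ∘ <⇒<ᵇ)))))

    ⟦⟧-split : ∀ x y z → (T x → y ≡ not z) → ⟦ x ∧ y ⟧ + ⟦ x ∧ z ⟧ ≡ ⟦ x ⟧
    ⟦⟧-split false y z _ = refl
    ⟦⟧-split true y z y≡¬z rewrite y≡¬z tt with z
    ... | true = refl
    ... | false = refl

    ∧-reassoc : ∀ a b c l → a ∧ b ∧ c ∧ l ≡ (a ∧ b ∧ c) ∧ l
    ∧-reassoc a b c l = sym (trans (∧-assoc a (b ∧ c) l) (cong (a ∧_) (∧-assoc b c l)))

    ∧-swap₂ : ∀ a b c l → b ∧ a ∧ c ∧ l ≡ (a ∧ b ∧ c) ∧ l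
    ∧-swap₂ true  true  c l = refl
    ∧-swap₂ true  false c l = refl
    ∧-swap₂ false true  c l = refl
    ∧-swap₂ false false c l = refl

  -- Each edge uw of G[P] is counted once in edgesIn, as the ordered pair with toℕ u < toℕ w.
  edgesIn-double : ∀ P → edgesIn G P + edgesIn G P ≡ 2|E| P
  edgesIn-double P = begin
    edgesIn G P + edgesIn G P
      ≡⟨ cong₂ _+_ edgesIn≡ edgesIn≡ ⟩
    sum (λ u → sum (forward u)) + sum (λ u → sum (forward u))
      ≡⟨ cong (sum (λ u → sum (forward u)) +_) (∑-comm forward) ⟩
    sum (λ u → sum (forward u)) + sum (λ u → sum (λ w → forward w u))
      ≡⟨ ∑-distrib-+ (λ u → sum (forward u)) (λ u → sum (λ w → forward w u)) ⟨
    sum (λ u → sum (forward u) + sum (λ w → forward w u))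
      ≡⟨ sum-cong-≗ (λ u → ∑-distrib-+ (forward u) (λ w → forward w u)) ⟨
    sum (λ u → sum (λ w → forward u w + forward w u))
      ≡⟨ sum-cong-≗ (λ u → sum-cong-≗ (λ w → both-directions u w)) ⟩
    sum (λ u → sum (λ w → 𝟙 P u * (𝟙 P w * Adj u w)))
      ≡⟨ ⟪⟫-expand (𝟙 P) (𝟙 P) ⟨
    2|E| P ∎
    where
    open ≡-Reasoning
    ordered-edge : Fin n → Fin n → Bool
    ordered-edge u w = lookup P u ∧ lookup P w ∧ adj G u w ∧ (toℕ u <ᵇ toℕ w)
    forward : Fin n → Fin n → ℕ
    forward u w = ⟦ ordered-edge u w ⟧
    edgesIn≡ : edgesIn G P ≡ sum (λ u → sum (forward u))
    edgesIn≡ = trans (sum-allFin (λ u → count (ordered-edge u))) (sum-cong-≗ (λ u → count≡# (ordered-edge u)))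
    both-directions : ∀ u w → forward u w + forward w u ≡ 𝟙 P u * (𝟙 P w * Adj u w)
    both-directions u w = begin
      forward u w + forward w u
        ≡⟨ cong₂ (λ x y → ⟦ x ⟧ + ⟦ y ⟧) (∧-reassoc (lookup P u) (lookup P w) _ _)
                                                    (trans (cong (λ e → lookup P w ∧ lookup P u ∧ e ∧ _) (Graph.sym G w u))
                                                           (∧-swap₂ (lookup P u) (lookup P w) _ _)) ⟩
      ⟦ edge ∧ (toℕ u <ᵇ toℕ w) ⟧ + ⟦ edge ∧ (toℕ w <ᵇ toℕ u) ⟧
        ≡⟨ ⟦⟧-split edge _ _ (<ᵇ-flip ∘ edge⇒≢) ⟩
      ⟦ edge ⟧
        ≡⟨ trans (⟦⟧-∧ (lookup P u) _) (cong (𝟙 P u *_) (⟦⟧-∧ (lookup P w) _)) ⟩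
      𝟙 P u * (𝟙 P w * Adj u w) ∎
      where
      edge : Bool
      edge = lookup P u ∧ lookup P w ∧ adj G u w
      edge⇒≢ : T edge → u ≢ w
      edge⇒≢ uw refl = subst T (Graph.irrefl G u)
        (proj₂ (Equivalence.to (T-∧ {lookup P u}) (proj₂ (Equivalence.to (T-∧ {lookup P u}) uw))))

  remove : Subset n → Fin n → Subset n
  remove P v = tabulate (λ u → lookup P u ∧ not (does (u ≟ᶠ v)))

  module _ {P : Subset n} {v : Fin n} (v∈P : T (lookup P v)) where

    𝟙-remove : ∀ u → 𝟙 P u ≡ 𝟙 (remove P v) u + δ v u
    𝟙-remove u rewrite lookup∘tabulate (λ u → lookup P u ∧ not (does (u ≟ᶠ v))) u with u ≟ᶠ v
    ... | yes refl rewrite ∧-zeroʳ (lookup P u) | δ-refl u = ⟦T⟧ v∈P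
    ... | no u≢v rewrite ∧-identityʳ (lookup P u) | δ-≢ (u≢v ∘ sym) = sym (+-identityʳ _)

    size-remove : size P ≡ suc (size (remove P v))
    size-remove = begin
      sum (𝟙 P)                                    ≡⟨ sum-cong-≗ 𝟙-remove ⟩
      sum (λ u → 𝟙 (remove P v) u + δ v u)         ≡⟨ ∑-distrib-+ (𝟙 (remove P v)) (δ v) ⟩
      size (remove P v) + sum (δ v)                ≡⟨ cong (size (remove P v) +_) (sum-δ-1 v) ⟩
      size (remove P v) + 1                        ≡⟨ +-comm _ 1 ⟩
      suc (size (remove P v))                      ∎
      where open ≡-Reasoning

    ⟪δ,remove⟫ : ⟪ δ v , 𝟙 (remove P v) ⟫ ≡ degIn G P v
    ⟪δ,remove⟫ = begin
      ⟪ δ v , P₁ ⟫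
        ≡⟨ ⟪δ,⟫ v P₁ ⟩
      sum (λ u → P₁ u * Adj v u)
        ≡⟨ +-identityʳ _ ⟨
      sum (λ u → P₁ u * Adj v u) + 0
        ≡⟨ cong (sum (λ u → P₁ u * Adj v u) +_) (trans (sum-δ v (Adj v)) (cong ⟦_⟧ (Graph.irrefl G v))) ⟨
      sum (λ u → P₁ u * Adj v u) + sum (λ u → δ v u * Adj v u)
        ≡⟨ ∑-distrib-+ (λ u → P₁ u * Adj v u) (λ u → δ v u * Adj v u) ⟨
      sum (λ u → P₁ u * Adj v u + δ v u * Adj v u)
        ≡⟨ sum-cong-≗ (λ u → trans (cong (_* Adj v u) (𝟙-remove u)) (*-distribʳ-+ (Adj v u) (P₁ u) (δ v u))) ⟨
      sum (λ u → 𝟙 P u * Adj v u)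
        ≡⟨ degIn≡ P v ⟨
      degIn G P v ∎
      where
      open ≡-Reasoning
      P₁ = 𝟙 (remove P v)

    2|E|-remove : 2|E| P ≡ 2|E| (remove P v) + (degIn G P v + degIn G P v)
    2|E|-remove = begin
      ⟪ 𝟙 P , 𝟙 P ⟫
        ≡⟨ ⟪⟫-cong 𝟙-remove 𝟙-remove ⟩
      ⟪ P₁+δ , P₁+δ ⟫
        ≡⟨ ⟪⟫-+ˡ P₁ (δ v) P₁+δ ⟩
      ⟪ P₁ , P₁+δ ⟫ + ⟪ δ v , P₁+δ ⟫
        ≡⟨ cong₂ _+_ (⟪⟫-+ʳ P₁ P₁ (δ v)) (⟪⟫-+ʳ (δ v) P₁ (δ v)) ⟩
      (⟪ P₁ , P₁ ⟫ + ⟪ P₁ , δ v ⟫) + (⟪ δ v , P₁ ⟫ + ⟪ δ v , δ v ⟫)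
        ≡⟨ cong₂ (λ x y → (⟪ P₁ , P₁ ⟫ + x) + (⟪ δ v , P₁ ⟫ + y)) (⟪⟫-comm P₁ (δ v)) (⟪δ,δ⟫ v) ⟩
      (⟪ P₁ , P₁ ⟫ + ⟪ δ v , P₁ ⟫) + (⟪ δ v , P₁ ⟫ + 0)
        ≡⟨ cong₂ (λ x y → (⟪ P₁ , P₁ ⟫ + x) + (y + 0)) ⟪δ,remove⟫ ⟪δ,remove⟫ ⟩
      (⟪ P₁ , P₁ ⟫ + degIn G P v) + (degIn G P v + 0)
        ≡⟨ solve 2 (λ e d → (e :+ d) :+ (d :+ con 0) := e :+ (d :+ d)) refl ⟪ P₁ , P₁ ⟫ (degIn G P v) ⟩
      2|E| (remove P v) + (degIn G P v + degIn G P v) ∎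
      where
      open ≡-Reasoning
      open +-*-Solver using (solve; _:+_; _:=_; con)
      P₁ = 𝟙 (remove P v)
      P₁+δ : Fin n → ℕ
      P₁+δ u = P₁ u + δ v u

ℤ-difference-≤ : ∀ a b c d → ℤ.+ a ℤ.- ℤ.+ b ℤ.≤ ℤ.+ c ℤ.- ℤ.+ d → a + d ≤ c + b
ℤ-difference-≤ a b c d h = ℤ.drop‿+≤+ (subst₂ ℤ._≤_
  (trans (cancel (ℤ.+ a) (ℤ.+ b) (ℤ.+ d)) (sym (ℤ.pos-+ a d)))
  (trans (cancel′ (ℤ.+ c) (ℤ.+ d) (ℤ.+ b)) (sym (ℤ.pos-+ c b)))
  (ℤ.+-monoˡ-≤ (ℤ.+ b ℤ.+ ℤ.+ d) h))
  where
  cancel : ∀ x y z → x ℤ.- y ℤ.+ (y ℤ.+ z) ≡ x ℤ.+ z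
  cancel = ℤ-solve-∀
  cancel′ : ∀ x y z → x ℤ.- y ℤ.+ (z ℤ.+ y) ≡ x ℤ.+ z
  cancel′ = ℤ-solve-∀

difference-trans : ∀ a b c x y z → a + y ≤ b + x → b + z ≤ c + y → a + z ≤ c + x
difference-trans a b c x y z ab bc = +-cancelʳ-≤ (b + y) (a + z) (c + x) (begin
  a + z + (b + y)         ≡⟨ solve 4 (λ a b y z → a :+ z :+ (b :+ y) := a :+ y :+ (b :+ z)) refl a b y z ⟩
  a + y + (b + z)         ≤⟨ +-mono-≤ ab bc ⟩
  b + x + (c + y)         ≡⟨ solve 4 (λ b c x y → b :+ x :+ (c :+ y) := c :+ x :+ (b :+ y)) refl b c x y ⟩
  c + x + (b + y)         ∎)
  where
  open ≤-Reasoning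
  open +-*-Solver using (solve; _:+_; _:=_)

exchange-arithmetic : ∀ k |D| |D′| |A| |S| e e′ sq ss deg out →
  |D′| + |A| ≡ |D| + |S| → e′ ≤ e + (sq + sq) + ss → sq + k * |A| ≤ deg → ss ≤ out + out → deg + out + 1 ≤ k * |S| →
  suc ((k + k) * |D| + e′) ≤ (k + k) * |D′| + e
exchange-arithmetic k |D| |D′| |A| |S| e e′ sq ss deg out sizes e′≤ sq≤ ss≤ deg≤ =
  +-cancelʳ-≤ ((k + k) * |A|) _ _ (begin
  suc ((k + k) * |D| + e′) + (k + k) * |A|
    ≤⟨ +-monoˡ-≤ ((k + k) * |A|) (s≤s (+-monoʳ-≤ ((k + k) * |D|) (≤-trans e′≤ (+-monoʳ-≤ (e + (sq + sq)) ss≤)))) ⟩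
  suc ((k + k) * |D| + (e + (sq + sq) + (out + out))) + (k + k) * |A|
    ≡⟨ solve 6 (λ k d a e sq o → con 1 :+ ((k :+ k) :* d :+ (e :+ (sq :+ sq) :+ (o :+ o))) :+ (k :+ k) :* a
                              := (k :+ k) :* d :+ e :+ ((sq :+ k :* a) :+ (sq :+ k :* a)) :+ (o :+ o) :+ con 1)
               refl k |D| |A| e sq out ⟩
  (k + k) * |D| + e + ((sq + k * |A|) + (sq + k * |A|)) + (out + out) + 1
    ≤⟨ +-monoˡ-≤ 1 (+-monoˡ-≤ (out + out) (+-monoʳ-≤ ((k + k) * |D| + e) (+-mono-≤ sq≤ sq≤))) ⟩
  (k + k) * |D| + e + (deg + deg) + (out + out) + 1
    ≡⟨ solve 5 (λ k d e g o → (k :+ k) :* d :+ e :+ (g :+ g) :+ (o :+ o) :+ con 1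
                            := (k :+ k) :* d :+ e :+ ((g :+ o :+ con 1) :+ (g :+ o))) refl k |D| e deg out ⟩
  (k + k) * |D| + e + ((deg + out + 1) + (deg + out))
    ≤⟨ +-monoʳ-≤ ((k + k) * |D| + e)
                 (+-mono-≤ deg≤ (≤-trans (n≤1+n _) (subst (_≤ k * |S|) (+-comm (deg + out) 1) deg≤))) ⟩
  (k + k) * |D| + e + (k * |S| + k * |S|)
    ≡⟨ solve 4 (λ k d e s → (k :+ k) :* d :+ e :+ (k :* s :+ k :* s) := (k :+ k) :* (d :+ s) :+ e) refl k |D| e |S| ⟩
  (k + k) * (|D| + |S|) + e
    ≡⟨ cong (λ m → (k + k) * m + e) sizes ⟨
  (k + k) * (|D′| + |A|) + e
    ≡⟨ solve 4 (λ k d a e → (k :+ k) :* (d :+ a) :+ e := (k :+ k) :* d :+ e :+ (k :+ k) :* a) refl k |D′| |A| e ⟩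
  (k + k) * |D′| + e + (k + k) * |A| ∎)
  where
  open ≤-Reasoning
  open +-*-Solver using (solve; _:+_; _:*_; _:=_; con)

module Optimality {n : ℕ} (G : Graph n) (k : ℕ) where
  open EdgeForm G

  -- P ≤φ P′ says 2φ_k(P) ≤ 2φ_k(P′), with both sides moved so that no subtraction occurs.
  _≤φ_ : Subset n → Subset n → Set
  P ≤φ P′ = (k + k) * size P + 2|E| P′ ≤ (k + k) * size P′ + 2|E| P

  _<φ_ : Subset n → Subset n → Set
  P <φ P′ = suc ((k + k) * size P + 2|E| P′) ≤ (k + k) * size P′ + 2|E| P

  <φ-irrefl : ∀ {P} → ¬ P <φ P
  <φ-irrefl = n≮n _

  <φ-≤φ-trans : ∀ {P P′ P″} → P <φ P′ → P′ ≤φ P″ → P <φ P″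
  <φ-≤φ-trans {P} {P′} {P″} = difference-trans (suc ((k + k) * size P)) ((k + k) * size P′) ((k + k) * size P″)
                                               (2|E| P) (2|E| P′) (2|E| P″)

  optimal-φ : ∀ {D P} → kOptimal k G D → kDependent k G P → P ≤φ D
  optimal-φ {D} {P} (_ , optimal) P-dependent = begin
    (k + k) * size P + 2|E| D                 ≡⟨ cong₂ _+_ (*-distribʳ-+ (size P) k k) (sym (edgesIn-double D)) ⟩
    (k * size P + k * size P) + (eD + eD)     ≡⟨ +-+-swap (k * size P) eD ⟩
    (k * size P + eD) + (k * size P + eD)     ≤⟨ +-mono-≤ φP≤φD φP≤φD ⟩
    (k * size D + eP) + (k * size D + eP)     ≡⟨ +-+-swap (k * size D) eP ⟨
    (k * size D + k * size D) + (eP + eP)     ≡⟨ cong₂ _+_ (sym (*-distribʳ-+ (size D) k k)) (edgesIn-double P) ⟩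
    (k + k) * size D + 2|E| P                 ∎
    where
    open ≤-Reasoning
    eD = edgesIn G D
    eP = edgesIn G P
    +-+-swap : ∀ a b → (a + a) + (b + b) ≡ (a + b) + (a + b)
    +-+-swap = solve 2 (λ a b → (a :+ a) :+ (b :+ b) := (a :+ b) :+ (a :+ b)) refl
      where open +-*-Solver using (solve; _:+_; _:=_)
    φP≤φD : k * size P + eD ≤ k * size D + eP
    φP≤φD = subst₂ (λ x y → k * x + eD ≤ k * y + eP) (∣∣≡size P) (∣∣≡size D)
      (ℤ-difference-≤ (k * ∣ P ∣) eP (k * ∣ D ∣) eD (optimal P P-dependent))

  -- Deleting a vertex of degree at least k from G[P] does not decrease φ_k.
  prune : ∀ fuel P → size P ≤ fuel → Σ (Subset n) λ P′ → kDependent k G P′ × P ≤φ P′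
  prune fuel P size≤fuel with any? (λ v → T? (lookup P v) ×-dec (k ≤? degIn G P v))
  ... | no ¬high = P , (λ v v∈P → ≰⇒> (λ k≤d → ¬high (v , v∈P , k≤d))) , ≤-refl
  ... | yes (v , v∈P , k≤d) = prune-from fuel size≤fuel
    where
    P₁ = remove P v
    d = degIn G P v
    prune-from : ∀ fuel → size P ≤ fuel → Σ (Subset n) λ P′ → kDependent k G P′ × P ≤φ P′
    prune-from zero size≤0 = ⊥-elim (<⇒≱ (subst (0 <_) (sym (size-remove {P} {v} v∈P)) z<s) size≤0)
    prune-from (suc fuel) size≤fuel with prune fuel P₁ (s≤s⁻¹ (subst (_≤ suc fuel) (size-remove {P} {v} v∈P) size≤fuel))
    ... | P′ , P′-dependent , φ₁≤φ′ = P′ , P′-dependent , (begin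
      (k + k) * size P + 2|E| P′
        ≡⟨ cong (λ s → (k + k) * s + 2|E| P′) (size-remove {P} {v} v∈P) ⟩
      (k + k) * suc (size P₁) + 2|E| P′
        ≡⟨ cong (_+ 2|E| P′) (*-suc (k + k) (size P₁)) ⟩
      (k + k) + (k + k) * size P₁ + 2|E| P′
        ≡⟨ +-assoc (k + k) _ _ ⟩
      (k + k) + ((k + k) * size P₁ + 2|E| P′)
        ≤⟨ +-mono-≤ (+-mono-≤ k≤d k≤d) φ₁≤φ′ ⟩
      (d + d) + ((k + k) * size P′ + 2|E| P₁)
        ≡⟨ solve 3 (λ x y z → x :+ (y :+ z) := y :+ (z :+ x)) refl (d + d) ((k + k) * size P′) (2|E| P₁) ⟩
      (k + k) * size P′ + (2|E| P₁ + (d + d))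
        ≡⟨ cong ((k + k) * size P′ +_) (2|E|-remove {P} {v} v∈P) ⟨
      (k + k) * size P′ + 2|E| P ∎)
      where
      open ≤-Reasoning
      open +-*-Solver using (solve; _:+_; _:=_)

module Exchange {n : ℕ} (G : Graph n) (D : Subset n) (k : ℕ) (c₀ : Fin k)
  (J : Fin n → Fin n → Bool) (J-orients : IsOrientation G (complementOf D) J) where
  open Augmenting G D k c₀ public
  open EdgeForm G
  open Optimality G k

  inX : ∀ v → T (lookup (complementOf D) v) → ¬ T (inD v)
  inX v v∈X = T-not⇒¬T (subst T (lookup∘tabulate (not ∘ inD) v) v∈X)

  X-edge-oriented : ∀ v u → ¬ T (inD v) → ¬ T (inD u) → T (adj G v u) → T (J v u) ⊎ T (J u v)
  X-edge-oriented v u ¬Dv ¬Du vu = proj₁ (proj₂ J-orients) v u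
    (subst T (sym (cong₂ (λ x y → x ∧ y ∧ adj G v u) (lookup∘tabulate (not ∘ inD) v) (lookup∘tabulate (not ∘ inD) u)))
       (Equivalence.from T-∧ (¬T⇒T-not ¬Dv , Equivalence.from T-∧ (¬T⇒T-not ¬Du , vu))))

  out : (Fin n → ℕ) → ℕ
  out s = sum (λ v → s v * outdeg J v)

  private
    oriented-point : ∀ x y e j j′ → (T x → T y → T e → T j ⊎ T j′) →
      ⟦ x ⟧ * (⟦ y ⟧ * ⟦ e ⟧) ≤ ⟦ x ⟧ * ⟦ j ⟧ + ⟦ y ⟧ * ⟦ j′ ⟧
    oriented-point false _     _     _     _     _ = z≤n
    oriented-point true  false _     _     _     _ = z≤n
    oriented-point true  true  false _     _     _ = z≤n
    oriented-point true  true  true  true  _     _ = s≤s z≤n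
    oriented-point true  true  true  false true  _ = s≤s z≤n
    oriented-point true  true  true  false false h with h tt tt tt
    ... | inj₁ ()
    ... | inj₂ ()

  -- Every edge inside a subset of X leaves one of its ends in J.
  ⟪S,S⟫≤out : ∀ (S : Fin n → Bool) → (∀ v → T (S v) → ¬ T (inD v)) →
    ⟪ ⟦_⟧ ∘ S , ⟦_⟧ ∘ S ⟫ ≤ out (⟦_⟧ ∘ S) + out (⟦_⟧ ∘ S)
  ⟪S,S⟫≤out S S⊆X = begin
    ⟪ s , s ⟫
      ≡⟨ ⟪⟫-expand s s ⟩
    sum (λ v → sum (λ u → s v * (s u * Adj v u)))
      ≤⟨ sum-mono-≤ (λ v → sum-mono-≤ (λ u → point v u)) ⟩
    sum (λ v → sum (λ u → s v * Jℕ v u + s u * Jℕ u v))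
      ≡⟨ sum-cong-≗ (λ v → ∑-distrib-+ (λ u → s v * Jℕ v u) (λ u → s u * Jℕ u v)) ⟩
    sum (λ v → sum (λ u → s v * Jℕ v u) + sum (λ u → s u * Jℕ u v))
      ≡⟨ ∑-distrib-+ (λ v → sum (λ u → s v * Jℕ v u)) (λ v → sum (λ u → s u * Jℕ u v)) ⟩
    sum (λ v → sum (λ u → s v * Jℕ v u)) + sum (λ v → sum (λ u → s u * Jℕ u v))
      ≡⟨ cong (sum (λ v → sum (λ u → s v * Jℕ v u)) +_) (∑-comm (λ v u → s u * Jℕ u v)) ⟩
    sum (λ v → sum (λ u → s v * Jℕ v u)) + sum (λ v → sum (λ u → s v * Jℕ v u))
      ≡⟨ cong₂ _+_ out≡ out≡ ⟩
    out s + out s ∎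
    where
    open ≤-Reasoning
    s : Fin n → ℕ
    s = ⟦_⟧ ∘ S
    Jℕ : Fin n → Fin n → ℕ
    Jℕ v u = ⟦ J v u ⟧
    point : ∀ v u → s v * (s u * Adj v u) ≤ s v * Jℕ v u + s u * Jℕ u v
    point v u = oriented-point (S v) (S u) (adj G v u) (J v u) (J u v)
      (λ Sv Su vu → X-edge-oriented v u (S⊆X v Sv) (S⊆X u Su) vu)
    out≡ : sum (λ v → sum (λ u → s v * Jℕ v u)) ≡ out s
    out≡ = sum-cong-≗ (λ v → trans (sym (*-distribˡ-sum (s v) (Jℕ v))) (cong (s v *_) (sym (count≡# (J v)))))

  private
    deficit-point : ∀ x d o y k → (T y → T x) → (T y → d + o + 1 ≤ k) → (¬ T y → T x → d + o ≤ k) →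
      ⟦ x ⟧ * d + ⟦ x ⟧ * o + ⟦ y ⟧ ≤ k * ⟦ x ⟧
    deficit-point false d o false k _ _ _ = z≤n
    deficit-point false d o true k y⇒x _ _ = ⊥-elim (y⇒x tt)
    deficit-point true d o true k _ h _
      rewrite *-identityˡ d | *-identityˡ o | *-identityʳ k = h tt
    deficit-point true d o false k _ _ h
      rewrite *-identityˡ d | *-identityˡ o | *-identityʳ k | +-identityʳ (d + o) = h (λ ()) tt

  deg+out<k|S| : ∀ {c} (S : Fin n → Bool) (v₀ : Fin n) → T (S v₀) → deg c v₀ + outdeg J v₀ < k →
    (∀ v → T (S v) → v ≢ v₀ → deg c v + outdeg J v ≤ k) →
    sum (λ v → ⟦ S v ⟧ * deg c v) + out (⟦_⟧ ∘ S) + 1 ≤ k * sum (⟦_⟧ ∘ S)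
  deg+out<k|S| {c} S v₀ Sv₀ v₀-deficient bounded = begin
    sum (λ v → ⟦ S v ⟧ * deg c v) + out (⟦_⟧ ∘ S) + 1
      ≡⟨ cong₂ _+_ (∑-distrib-+ (λ v → ⟦ S v ⟧ * deg c v) (λ v → ⟦ S v ⟧ * outdeg J v)) (sum-δ-1 v₀) ⟨
    sum (λ v → ⟦ S v ⟧ * deg c v + ⟦ S v ⟧ * outdeg J v) + sum (δ v₀)
      ≡⟨ ∑-distrib-+ (λ v → ⟦ S v ⟧ * deg c v + ⟦ S v ⟧ * outdeg J v) (δ v₀) ⟨
    sum (λ v → ⟦ S v ⟧ * deg c v + ⟦ S v ⟧ * outdeg J v + δ v₀ v)
      ≤⟨ sum-mono-≤ (λ v → deficit-point (S v) (deg c v) (outdeg J v) (does (v₀ ≟ᶠ v)) k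
                             (λ v₀≟v → subst (T ∘ S) (does-sound (v₀ ≟ᶠ v) v₀≟v) Sv₀)
                             (λ v₀≟v → subst (λ u → deg c u + outdeg J u + 1 ≤ k) (does-sound (v₀ ≟ᶠ v) v₀≟v)
                                             (subst (_≤ k) (+-comm 1 _) v₀-deficient))
                             (λ ¬v₀≟v Sv → bounded v Sv (λ v≡v₀ → ¬v₀≟v (does-complete (v₀ ≟ᶠ v) (sym v≡v₀))))) ⟩
    sum (λ v → k * ⟦ S v ⟧)
      ≡⟨ *-distribˡ-sum k (⟦_⟧ ∘ S) ⟨
    k * sum (⟦_⟧ ∘ S) ∎
    where open ≤-Reasoning

  module ExchangeAlong (R : Fin n → Bool) where
    S A Q : Fin n → Bool
    S v = not (inD v) ∧ R v
    A v = inD v ∧ R v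
    Q v = inD v ∧ not (R v)

    s a q : Fin n → ℕ
    s = ⟦_⟧ ∘ S
    a = ⟦_⟧ ∘ A
    q = ⟦_⟧ ∘ Q

    D′ : Subset n
    D′ = tabulate (λ v → Q v ∨ S v)

    S-intro : ∀ v → ¬ T (inD v) → T (R v) → T (S v)
    S-intro v ¬Dv Rv = Equivalence.from T-∧ (¬T⇒T-not ¬Dv , Rv)

    S⇒X : ∀ v → T (S v) → ¬ T (inD v)
    S⇒X v = T-not⇒¬T ∘ proj₁ ∘ Equivalence.to T-∧

    S⇒R : ∀ v → T (S v) → T (R v)
    S⇒R v = proj₂ ∘ Equivalence.to T-∧

    A⇒D : ∀ v → T (A v) → T (inD v)
    A⇒D v = proj₁ ∘ Equivalence.to T-∧

    A⇒R : ∀ v → T (A v) → T (R v)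
    A⇒R v = proj₂ ∘ Equivalence.to T-∧

    Q⇒D : ∀ v → T (Q v) → T (inD v)
    Q⇒D v = proj₁ ∘ Equivalence.to T-∧

    Q⇒¬R : ∀ v → T (Q v) → ¬ T (R v)
    Q⇒¬R v = T-not⇒¬T ∘ proj₂ ∘ Equivalence.to T-∧

    private
      𝟙D′ : ∀ v → 𝟙 D′ v ≡ q v + s v
      𝟙D′ v rewrite lookup∘tabulate (λ v → Q v ∨ S v) v with inD v | R v
      ... | true  | true  = refl
      ... | true  | false = refl
      ... | false | true  = refl
      ... | false | false = refl

      𝟙D : ∀ v → 𝟙 D v ≡ q v + a v
      𝟙D v with inD v | R v
      ... | true  | true  = refl
      ... | true  | false = refl
      ... | false | true  = refl
      ... | false | false = refl

    size-exchange : size D′ + sum a ≡ size D + sum s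
    size-exchange = begin
      size D′ + sum a                ≡⟨ cong (_+ sum a) (trans (sum-cong-≗ 𝟙D′) (∑-distrib-+ q s)) ⟩
      sum q + sum s + sum a          ≡⟨ solve 3 (λ x y z → x :+ y :+ z := x :+ z :+ y) refl (sum q) (sum s) (sum a) ⟩
      sum q + sum a + sum s          ≡⟨ cong (_+ sum s) (trans (sum-cong-≗ 𝟙D) (∑-distrib-+ q a)) ⟨
      size D + sum s                 ∎
      where
      open ≡-Reasoning
      open +-*-Solver using (solve; _:+_; _:=_)

    2|E|-exchange : 2|E| D′ ≤ 2|E| D + (⟪ s , q ⟫ + ⟪ s , q ⟫) + ⟪ s , s ⟫
    2|E|-exchange = begin
      ⟪ 𝟙 D′ , 𝟙 D′ ⟫
        ≡⟨ ⟪⟫-cong 𝟙D′ 𝟙D′ ⟩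
      ⟪ q+s , q+s ⟫
        ≡⟨ ⟪⟫-+ˡ q s q+s ⟩
      ⟪ q , q+s ⟫ + ⟪ s , q+s ⟫
        ≡⟨ cong₂ _+_ (⟪⟫-+ʳ q q s) (⟪⟫-+ʳ s q s) ⟩
      (⟪ q , q ⟫ + ⟪ q , s ⟫) + (⟪ s , q ⟫ + ⟪ s , s ⟫)
        ≤⟨ +-monoˡ-≤ _ (+-mono-≤ (⟪⟫-mono q≤𝟙D q≤𝟙D) (≤-reflexive (⟪⟫-comm q s))) ⟩
      (2|E| D + ⟪ s , q ⟫) + (⟪ s , q ⟫ + ⟪ s , s ⟫)
        ≡⟨ solve 3 (λ x y z → (x :+ y) :+ (y :+ z) := x :+ (y :+ y) :+ z) refl (2|E| D) ⟪ s , q ⟫ ⟪ s , s ⟫ ⟩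
      2|E| D + (⟪ s , q ⟫ + ⟪ s , q ⟫) + ⟪ s , s ⟫ ∎
      where
      open ≤-Reasoning
      open +-*-Solver using (solve; _:+_; _:=_)
      q+s : Fin n → ℕ
      q+s v = q v + s v
      q≤𝟙D : ∀ v → q v ≤ 𝟙 D v
      q≤𝟙D v = subst (q v ≤_) (sym (𝟙D v)) (m≤m+n (q v) (a v))

    private
      exchange-point : ∀ dv rv du ru e f →
        (T (not dv ∧ rv) → T (du ∧ not ru) → T e → T f) → (T (du ∧ ru) → T f → T (not dv ∧ rv)) →
        ⟦ not dv ∧ rv ⟧ * (⟦ du ∧ not ru ⟧ * ⟦ e ⟧) + ⟦ du ∧ ru ⟧ * ⟦ f ⟧ ≤ ⟦ not dv ∧ rv ⟧ * ⟦ f ⟧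
      exchange-point false true  false _     _     _     _  _  = z≤n
      exchange-point false true  true  false false _     _  _  = z≤n
      exchange-point false true  true  false true  false h₁ _  = ⊥-elim (h₁ tt tt tt)
      exchange-point false true  true  false true  true  _  _  = s≤s z≤n
      exchange-point false true  true  true  _     f     _  _  = ≤-refl
      exchange-point true  _     false _     _     _     _  _  = z≤n
      exchange-point true  _     true  false _     _     _  _  = z≤n
      exchange-point true  _     true  true  _     false _  _  = z≤n
      exchange-point true  _     true  true  _     true  _  h₂ = ⊥-elim (h₂ tt tt)
      exchange-point false false false _     _     _     _  _  = z≤n
      exchange-point false false true  false _     _     _  _  = z≤n
      exchange-point false false true  true  _     false _  _  = z≤n
      exchange-point false false true  true  _     true  _  h₂ = ⊥-elim (h₂ tt tt)

    -- Closure of R makes every S–Q edge coloured and every coloured edge at A end in S, so the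
    -- colour degrees in S pay for the S–Q edges and for the saturated vertices of A.
    ⟪s,q⟫+k|A|≤deg : ∀ {c} → Proper c → (∀ u w → T (R u) → T (alternating c u w) → T (R w)) →
      (∀ u → T (A u) → k ≤ deg c u) → ⟪ s , q ⟫ + k * sum a ≤ sum (λ v → s v * deg c v)
    ⟪s,q⟫+k|A|≤deg {c} pc closed saturated = begin
      ⟪ s , q ⟫ + k * sum a
        ≡⟨ cong₂ _+_ (⟪⟫-expand s q) (*-distribˡ-sum k a) ⟩
      sum (λ v → sum (λ u → s v * (q u * Adj v u))) + sum (λ u → k * a u)
        ≤⟨ +-monoʳ-≤ _ (sum-mono-≤ k≤deg) ⟩
      sum (λ v → sum (λ u → s v * (q u * Adj v u))) + sum (λ u → a u * deg c u)
        ≡⟨ cong (sum (λ v → sum (λ u → s v * (q u * Adj v u))) +_)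
                (trans (sum-cong-≗ (λ u → *-distribˡ-sum (a u) (F u))) (∑-comm (λ u v → a u * F u v))) ⟩
      sum (λ v → sum (λ u → s v * (q u * Adj v u))) + sum (λ v → sum (λ u → a u * F u v))
        ≡⟨ ∑-distrib-+ (λ v → sum (λ u → s v * (q u * Adj v u))) (λ v → sum (λ u → a u * F u v)) ⟨
      sum (λ v → sum (λ u → s v * (q u * Adj v u)) + sum (λ u → a u * F u v))
        ≡⟨ sum-cong-≗ (λ v → ∑-distrib-+ (λ u → s v * (q u * Adj v u)) (λ u → a u * F u v)) ⟨
      sum (λ v → sum (λ u → s v * (q u * Adj v u) + a u * F u v))
        ≤⟨ sum-mono-≤ (λ v → sum-mono-≤ (λ u → point v u)) ⟩
      sum (λ v → sum (λ u → s v * F v u))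
        ≡⟨ sum-cong-≗ (λ v → *-distribˡ-sum (s v) (F v)) ⟨
      sum (λ v → s v * deg c v) ∎
      where
      open ≤-Reasoning
      F : Fin n → Fin n → ℕ
      F v u = ⟦ is-just (c v u) ⟧
      k≤deg : ∀ u → k * a u ≤ a u * deg c u
      k≤deg u with T? (A u)
      ... | no ¬Au rewrite ⟦¬T⟧ ¬Au | *-zeroʳ k = z≤n
      ... | yes Au rewrite ⟦T⟧ Au | *-identityʳ k | +-identityʳ (deg c u) = saturated u Au
      point : ∀ v u → s v * (q u * Adj v u) + a u * F u v ≤ s v * F v u
      point v u rewrite symmetric pc u v = exchange-point (inD v) (R v) (inD u) (R u) (adj G v u) (is-just (c v u))
        (λ Sv Qu vu → decidable-stable (T? (is-just (c v u))) λ ¬coloured →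
           Q⇒¬R u Qu (closed v u (S⇒R v Sv) (alternating-intro-X {c} (S⇒X v Sv) (Q⇒D u Qu) vu ¬coloured)))
        (λ Au coloured → let coloured′ = subst (T ∘ is-just) (symmetric pc v u) coloured in
           S-intro v (HEdge-from-D (in-H pc u v coloured′) (A⇒D u Au))
             (closed u v (A⇒R u Au) (alternating-intro-D pc (A⇒D u Au) coloured′)))

  -- Vertices of X without coloured edges are exempt: their out-degree in J may exceed k.
  Bounded : Colouring → Set
  Bounded c = ∀ v → ¬ T (inD v) → 1 ≤ deg c v → deg c v + outdeg J v ≤ k

  -- Exchanging R ∩ D for R ∩ X in D would strictly increase φ_k.
  no-saturated-closed-set : kOptimal k G D → ∀ {c} → Proper c → Bounded c →
    ∀ v₀ → ¬ T (inD v₀) → deg c v₀ + outdeg J v₀ < k →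
    ∀ R → T (R v₀) → (∀ u w → T (R u) → T (alternating c u w) → T (R w)) →
    (∀ u → T (R u) → T (inD u) → k ≤ deg c u) → (∀ v → T (R v) → ¬ T (inD v) → v ≢ v₀ → 1 ≤ deg c v) → ⊥
  no-saturated-closed-set D-optimal {c} pc bounded v₀ ¬Dv₀ v₀-deficient R Rv₀ closed saturated entered =
    <φ-irrefl {D} (<φ-≤φ-trans {D} {P} {D} (<φ-≤φ-trans {D} {D′} {P} D<φD′ D′≤φP)
                                           (optimal-φ {D} {P} D-optimal P-dependent))
    where
    open ExchangeAlong R
    D<φD′ : D <φ D′
    D<φD′ = exchange-arithmetic k (size D) (size D′) (sum a) (sum s) (2|E| D) (2|E| D′) ⟪ s , q ⟫ ⟪ s , s ⟫
      (sum (λ v → s v * deg c v)) (out s) size-exchange 2|E|-exchange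
      (⟪s,q⟫+k|A|≤deg pc closed (λ u Au → saturated u (A⇒R u Au) (A⇒D u Au)))
      (⟪S,S⟫≤out S S⇒X)
      (deg+out<k|S| S v₀ (S-intro v₀ ¬Dv₀ Rv₀) v₀-deficient
        (λ v Sv v≢v₀ → bounded v (S⇒X v Sv) (entered v (S⇒R v Sv) (S⇒X v Sv) v≢v₀)))
    pruned = prune (size D′) D′ ≤-refl
    P = proj₁ pruned
    P-dependent = proj₁ (proj₂ pruned)
    D′≤φP = proj₂ (proj₂ pruned)

  entered-from-D : ∀ {c} → Proper c → ∀ {v₀ v vs} → Reachability.Path (alternating c) v₀ v vs →
    ¬ T (inD v) → v ≢ v₀ → 1 ≤ deg c v
  entered-from-D pc Reachability.start ¬Dv v≢v₀ = ⊥-elim (v≢v₀ refl)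
  entered-from-D {c} pc (Reachability.snoc {a} {v} p av _) ¬Dv v≢v₀ with T? (inD a)
  ... | yes Da = #-≥1 (support c v) a (subst (T ∘ is-just) (symmetric pc a v) (alternating-from-D {c} Da av))
  ... | no ¬Da = ⊥-elim (¬Dv (HEdge-from-X (proj₁ (alternating-from-X {c} ¬Da av)) ¬Da))

  module _ (D-optimal : kOptimal k G D) where

    improve : ∀ {c} → Proper c → Bounded c → ∀ v₀ → ¬ T (inD v₀) → deg c v₀ + outdeg J v₀ < k →
      Σ Colouring λ c′ → Proper c′ × Bounded c′ × deg c′ v₀ ≡ suc (deg c v₀) × PreservesX v₀ c c′
    improve {c} pc bounded v₀ ¬Dv₀ v₀-deficient
      with Reachability.search (alternating c) v₀ (λ t → inD t ∧ (deg c t <ᵇ k))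
    ... | inj₁ (t , vs , p , t-free) =
      let Dt , deg<k = Equivalence.to T-∧ t-free
          c′ , pc′ , deg-v₀ , X-preserved = augment (length vs) ≤-refl pc p Dt (<ᵇ⇒< _ _ deg<k) ¬Dv₀ v₀-free
      in c′ , pc′ , bounded′ c′ deg-v₀ X-preserved , deg-v₀ , X-preserved
      where
      v₀-free : deg c v₀ < k
      v₀-free = ≤-<-trans (m≤m+n (deg c v₀) (outdeg J v₀)) v₀-deficient
      bounded′ : ∀ c′ → deg c′ v₀ ≡ suc (deg c v₀) → PreservesX v₀ c c′ → Bounded c′
      bounded′ c′ deg-v₀ X-preserved v ¬Dv 1≤deg with v ≟ᶠ v₀
      ... | yes refl = subst (λ d → d + outdeg J v ≤ k) (sym deg-v₀) v₀-deficient
      ... | no v≢v₀ rewrite X-preserved v ¬Dv v≢v₀ = bounded v ¬Dv 1≤deg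
    ... | inj₂ (R , explored , closed) =
      ⊥-elim (no-saturated-closed-set D-optimal pc bounded v₀ ¬Dv₀ v₀-deficient R source closed saturated
                (λ v Rv ¬Dv v≢v₀ → entered-from-D pc (proj₁ (proj₂ (reached v Rv))) ¬Dv v≢v₀))
      where
      open Reachability.Explored explored
      saturated : ∀ u → T (R u) → T (inD u) → k ≤ deg c u
      saturated u Ru Du = ≮⇒≥ λ deg<k → avoids u Ru (Equivalence.from T-∧ (Du , <⇒<ᵇ deg<k))

    saturate : (fuel : ℕ) → ∀ {c} → Proper c → Bounded c → ∀ v₀ → ¬ T (inD v₀) → k ≤ deg c v₀ + fuel →
      Σ Colouring λ c′ → Proper c′ × Bounded c′ × k ≤ deg c′ v₀ + outdeg J v₀ × PreservesX v₀ c c′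
    saturate fuel {c} pc bounded v₀ ¬Dv₀ k≤ with k ≤? deg c v₀ + outdeg J v₀
    ... | yes saturated = c , pc , bounded , saturated , λ _ _ _ → refl
    saturate zero {c} pc bounded v₀ ¬Dv₀ k≤ | no ¬saturated =
      ⊥-elim (¬saturated (≤-trans k≤ (≤-trans (≤-reflexive (+-identityʳ _)) (m≤m+n _ _))))
    saturate (suc fuel) {c} pc bounded v₀ ¬Dv₀ k≤ | no ¬saturated
      with improve pc bounded v₀ ¬Dv₀ (≰⇒> ¬saturated)
    ... | c₁ , pc₁ , bounded₁ , deg-v₀ , X-preserved₁
      with saturate fuel pc₁ bounded₁ v₀ ¬Dv₀ (subst (k ≤_) (trans (+-suc _ fuel) (cong (_+ fuel) (sym deg-v₀))) k≤)
    ... | c₂ , pc₂ , bounded₂ , saturated , X-preserved₂ =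
      c₂ , pc₂ , bounded₂ , saturated , λ v ¬Dv v≢v₀ → trans (X-preserved₂ v ¬Dv v≢v₀) (X-preserved₁ v ¬Dv v≢v₀)

    saturate-all : (L : List (Fin n)) →
      Σ Colouring λ c → Proper c × Bounded c × (∀ v → v ∈ L → ¬ T (inD v) → k ≤ deg c v + outdeg J v)
    saturate-all [] = empty , empty-proper , (λ v _ 1≤0 → ⊥-elim (<⇒≱ 1≤0 (≤-reflexive (sum-replicate-zero n)))) , λ _ ()
    saturate-all (w ∷ L) with saturate-all L | T? (inD w)
    ... | c , pc , bounded , done | yes Dw =
      c , pc , bounded , λ { v (here refl) ¬Dv → ⊥-elim (¬Dv Dw) ; v (there v∈L) → done v v∈L }
    ... | c , pc , bounded , done | no ¬Dw
      with saturate k pc bounded w ¬Dw (m≤n+m k (deg c w))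
    ...   | c′ , pc′ , bounded′ , w-done , X-preserved = c′ , pc′ , bounded′ , done′
      where
      done′ : ∀ v → v ∈ w ∷ L → ¬ T (inD v) → k ≤ deg c′ v + outdeg J v
      done′ v (here refl) ¬Dv = w-done
      done′ v (there v∈L) ¬Dv with v ≟ᶠ w
      ... | yes refl = w-done
      ... | no v≢w rewrite X-preserved v ¬Dv v≢w = done v v∈L ¬Dv

theorem1p4 : ∀ {n} (G : Graph n) (k : ℕ) → 1 ≤ k → (D : Subset n) → kOptimal k G D →
    (J : Fin n → Fin n → Bool) → IsOrientation G (complementOf D) J →
    Σ (Fin n → Fin n → Bool) λ M →
      IsSubgraphOfH G D M × KEdgeChromatic k M ×
      (∀ v → T (lookup (complementOf D) v) → k ≤ degM M v + outdeg J v)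
theorem1p4 {n} G (suc k) (s≤s z≤n) D D-optimal J J-orients =
  let c , pc , _ , saturated = saturate-all D-optimal (List.allFin n)
  in support c , support-⊆H pc , support-chromatic pc ,
     λ v v∈X → subst (λ d → suc k ≤ d + outdeg J v) (sym (count≡# (support c v)))
                     (saturated v (∈-allFin v) (inX v v∈X))
  where open Exchange G D (suc k) zero J J-orients
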